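{- Let $\sigma$ be a multi-sorted algebraic signature and let $\mathcal{C}$ be a finite product category that is free on $\sigma$ via an interpretation $i:\sigma\to\mathcal{C}$. Let $\mathcal{D}$ be a 2-category with finite 2-categorical products and let $M,N:\sigma\to\mathcal{D}$ be interpretations. Let $\widetilde{M},\widetilde{N}:\mathcal{C}\to\mathcal{D}$ be the unique finite-product-preserving functors with $\widetilde{M}\circ i=M$ and $\widetilde{N}\circ i=N$. Then $M$ and $N$ are homotopy-equivalent if and only if $\widetilde{M}$ and $\widetilde{N}$ are pseudonaturally equivalent.
   Context: An algebraic signature $\sigma$ consists of a set of sorts and, for each finite sequence $\vec A$ of sorts and sort $B$, a set $\sigma(\vec A,B)$ of function symbols. An interpretation $M$ of $\sigma$ in a finite product category $\mathcal{E}$ consists of an object $MA$ for each sort, a chosen product diagram $\{\pi_i:M\vec A\to MA_i\}$ for each finite sequence $\vec A$ (with $M\langle A\rangle=MA$, $\pi_1=\mathrm{id}$), and a morphism $Mf:M\vec A\to MB$ for each $f\in\sigma(\vec A,B)$. Homomorphisms $\alpha:M\to N$ are families $\alpha_A:MA\to NA$ with $\alpha_B\circ Mf=Nf\circ\alpha_{\vec A}$, where $\alpha_{\vec A}=\alpha_{A_1}\times\cdots\times\alpha_{A_n}$; these form a category $\mathrm{Int}(\sigma,\mathcal{E})$. For a finite-product-preserving (f.p.) functor $F:\mathcal{E}\to\mathcal{E}'$, $F\circ M$ is the interpretation $A\mapsto F(MA)$, $\vec A\mapsto F(M\vec A)$ with projections $F\pi_i$, $f\mapsto F(Mf)$; this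 extends to a functor $\mathrm{FPFun}(\mathcal{E},\mathcal{E}')\to\mathrm{Int}(\sigma,\mathcal{E}')$. $\mathcal{C}$ is free on $\sigma$ via $i$ if this functor (for $M=i$) is an isomorphism of categories for every finite product category $\mathcal{E}'$. A 2-categorical product of $A,B$ is a product in the underlying category such that for every $X$ the induced functor $\mathrm{HOM}(X,A\times B)\to\mathrm{HOM}(X,A)\times\mathrm{HOM}(X,B)$ is an isomorphism of categories. Given interpretations $M,N:\sigma\to\mathcal{D}$, a homotopy homomorphism $\alpha:M\to N$ consists of 1-cells $\alpha_A:MA\to NA$ and invertible 2-cells $\alpha_f:\alpha_B\circ Mf\Rightarrow Nf\circ\alpha_{\vec A}$ for each $f\in\sigma(\vec A,B)$; it is a homotopy-equivalence if each $\alpha_A$ is an equivalence in $\mathcal{D}$ (a 1-cell with a quasi-inverse up to invertible 2-cells). For functors $F,G$ from a category to $\mathcal{D}$, a pseudonatural transformation $\beta:F\to G$ consists of 1-cells $\beta_X:FX\to GX$ and invertible 2-cells $\beta_f:\beta_Y\circ Ff\Rightarrow Gf\circ\beta_X$ with $(\mathrm{id}_{Gg}\circ\beta_f)(\beta_g\circ\mathrm{id}_{Ff})=\beta_{gf}$ and $\beta_{\mathrm{id}}=\mathrm{id}$; it is a pseudonatural equivalence if every $\beta_X$ is an equivalence. -}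

module Defs where

open import Level using (Level; _⊔_; Setω) renaming (suc to lsuc)
open import Data.Fin using (Fin; zero; suc)
open import Data.List using (List; length; lookup; [_])
open import Data.Product using (Σ; _,_; _×_; proj₁; proj₂)
open import Relation.Binary.Structures using (IsEquivalence)
open import Relation.Binary.PropositionalEquality
  using (_≡_; refl; sym; trans; cong; cong₂; subst; isEquivalence)

record Category (o ℓ e : Level) : Set (lsuc (o ⊔ ℓ ⊔ e)) where
  infix  4 _≈_ _⇒_
  infixr 9 _∘_
  field
    Obj       : Set o
    _⇒_       : Obj → Obj → Set ℓ
    _≈_       : ∀ {A B} → A ⇒ B → A ⇒ B → Set e
    id        : ∀ {A} → A ⇒ A
    _∘_       : ∀ {A B C} → B ⇒ C → A ⇒ B → A ⇒ C
    ≈-equiv   : ∀ {A B} → IsEquivalence (_≈_ {A} {B})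
    ∘-resp-≈  : ∀ {A B C} {f h : B ⇒ C} {g i : A ⇒ B} →
                f ≈ h → g ≈ i → f ∘ g ≈ h ∘ i
    assoc     : ∀ {A B C D} {f : A ⇒ B} {g : B ⇒ C} {h : C ⇒ D} →
                (h ∘ g) ∘ f ≈ h ∘ (g ∘ f)
    identityˡ : ∀ {A B} {f : A ⇒ B} → id ∘ f ≈ f
    identityʳ : ∀ {A B} {f : A ⇒ B} → f ∘ id ≈ f

  idTo : ∀ {A B} → A ≡ B → A ⇒ B
  idTo refl = id

  _≈[_,_]_ : ∀ {A B A′ B′} → A ⇒ B → A ≡ A′ → B ≡ B′ → A′ ⇒ B′ → Set e
  f ≈[ p , q ] g = idTo q ∘ f ≈ g ∘ idTo p

  record IsProduct {n : _} (X : Fin n → Obj) (P : Obj) (π : (i : Fin n) → P ⇒ X i)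
         : Set (o ⊔ ℓ ⊔ e) where
    field
      ⟨_⟩     : ∀ {Q} → ((i : Fin n) → Q ⇒ X i) → Q ⇒ P
      commute : ∀ {Q} (f : (i : Fin n) → Q ⇒ X i) (i : Fin n) → π i ∘ ⟨ f ⟩ ≈ f i
      unique  : ∀ {Q} (f : (i : Fin n) → Q ⇒ X i) (h : Q ⇒ P) →
                ((i : Fin n) → π i ∘ h ≈ f i) → h ≈ ⟨ f ⟩

  record Product {n : _} (X : Fin n → Obj) : Set (o ⊔ ℓ ⊔ e) where
    field
      P         : Obj
      π         : (i : Fin n) → P ⇒ X i
      isProduct : IsProduct X P π

  HasFiniteProducts : Set (o ⊔ ℓ ⊔ e)
  HasFiniteProducts = (n : _) (X : Fin n → Obj) → Product X

record FPCat (o ℓ e : Level) : Set (lsuc (o ⊔ ℓ ⊔ e)) where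
  field
    cat      : Category o ℓ e
    products : Category.HasFiniteProducts cat

module _ {o ℓ e o′ ℓ′ e′} (C : Category o ℓ e) (D : Category o′ ℓ′ e′) where
  private
    module C = Category C
    module D = Category D

  record Functor : Set (o ⊔ ℓ ⊔ e ⊔ o′ ⊔ ℓ′ ⊔ e′) where
    field
      F₀           : C.Obj → D.Obj
      F₁           : ∀ {A B} → A C.⇒ B → F₀ A D.⇒ F₀ B
      identity     : ∀ {A} → F₁ (C.id {A}) D.≈ D.id
      homomorphism : ∀ {A B E} {f : A C.⇒ B} {g : B C.⇒ E} →
                     F₁ (g C.∘ f) D.≈ F₁ g D.∘ F₁ f
      F-resp-≈     : ∀ {A B} {f g : A C.⇒ B} → f C.≈ g → F₁ f D.≈ F₁ g

  PreservesFiniteProducts : Functor → Set (o ⊔ ℓ ⊔ e ⊔ o′ ⊔ ℓ′ ⊔ e′)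
  PreservesFiniteProducts F =
    ∀ {n} {X : Fin n → C.Obj} {P : C.Obj} {π : (i : Fin n) → P C.⇒ X i} →
    C.IsProduct X P π →
    D.IsProduct (λ i → F₀ (X i)) (F₀ P) (λ i → F₁ (π i))
    where open Functor F

  record FPFunctor : Set (o ⊔ ℓ ⊔ e ⊔ o′ ⊔ ℓ′ ⊔ e′) where
    field
      functor   : Functor
      preserves : PreservesFiniteProducts functor
    open Functor functor public

  record NatTrans (F G : FPFunctor) : Set (o ⊔ ℓ ⊔ e ⊔ o′ ⊔ ℓ′ ⊔ e′) where
    private
      module F = FPFunctor F
      module G = FPFunctor G
    field
      η       : (X : C.Obj) → F.F₀ X D.⇒ G.F₀ X
      commute : ∀ {X Y} (f : X C.⇒ Y) → η Y D.∘ F.F₁ f D.≈ G.F₁ f D.∘ η X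

  record _≐F_ (F G : FPFunctor) : Set (o ⊔ ℓ ⊔ e ⊔ o′ ⊔ ℓ′ ⊔ e′) where
    private
      module F = FPFunctor F
      module G = FPFunctor G
    field
      obj≡ : (X : C.Obj) → F.F₀ X ≡ G.F₀ X
      hom≈ : ∀ {X Y} (f : X C.⇒ Y) → F.F₁ f D.≈[ obj≡ X , obj≡ Y ] G.F₁ f

record Signature (s f : Level) : Set (lsuc (s ⊔ f)) where
  field
    Sort : Set s
    Fun  : List Sort → Sort → Set f

module _ {s f} (σ : Signature s f) where
  open Signature σ

  module _ {o ℓ e} (E : Category o ℓ e) where
    open Category E

    record Interpretation : Set (s ⊔ f ⊔ o ⊔ ℓ ⊔ e) where
      field
        ⟦_⟧       : Sort → Obj
        ⟦_⟧*      : List Sort → Obj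
        π         : (As : List Sort) (i : Fin (length As)) → ⟦ As ⟧* ⇒ ⟦ lookup As i ⟧
        isProduct : (As : List Sort) →
                    IsProduct (λ i → ⟦ lookup As i ⟧) ⟦ As ⟧* (π As)
        single    : (A : Sort) → ⟦ [ A ] ⟧* ≡ ⟦ A ⟧
        single-π  : (A : Sort) → π [ A ] zero ≈ idTo (single A)
        ⟦_⟧f      : ∀ {As B} → Fun As B → ⟦ As ⟧* ⇒ ⟦ B ⟧

    module _ (M N : Interpretation) where
      private
        module M = Interpretation M
        module N = Interpretation N

      ×map : (α : (A : Sort) → M.⟦ A ⟧ ⇒ N.⟦ A ⟧) (As : List Sort) → M.⟦ As ⟧* ⇒ N.⟦ As ⟧*
      ×map α As = IsProduct.⟨_⟩ (N.isProduct As) (λ i → α (lookup As i) ∘ M.π As i)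

      record Homomorphism : Set (s ⊔ f ⊔ o ⊔ ℓ ⊔ e) where
        field
          α       : (A : Sort) → M.⟦ A ⟧ ⇒ N.⟦ A ⟧
          commute : ∀ {As B} (g : Fun As B) → α B ∘ M.⟦ g ⟧f ≈ N.⟦ g ⟧f ∘ ×map α As

      record _≐_ : Set (s ⊔ f ⊔ o ⊔ ℓ ⊔ e) where
        field
          sort≡ : (A : Sort) → M.⟦ A ⟧ ≡ N.⟦ A ⟧
          prod≡ : (As : List Sort) → M.⟦ As ⟧* ≡ N.⟦ As ⟧*
          π≈    : (As : List Sort) (i : Fin (length As)) →
                  M.π As i ≈[ prod≡ As , sort≡ (lookup As i) ] N.π As i
          fun≈  : ∀ {As B} (g : Fun As B) → M.⟦ g ⟧f ≈[ prod≡ As , sort≡ B ] N.⟦ g ⟧f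

  module _ {o ℓ e o′ ℓ′ e′} {C : Category o ℓ e} {E : Category o′ ℓ′ e′} where
    private
      module C = Category C
      module E = Category E

    _∘I_ : FPFunctor C E → Interpretation C → Interpretation E
    F ∘I M = record
      { ⟦_⟧       = λ A → F₀ (M.⟦ A ⟧)
      ; ⟦_⟧*      = λ As → F₀ (M.⟦ As ⟧*)
      ; π         = λ As i → F₁ (M.π As i)
      ; isProduct = λ As → preserves (M.isProduct As)
      ; single    = λ A → cong F₀ (M.single A)
      ; single-π  = λ A → IsEquivalence.trans E.≈-equiv
                            (F-resp-≈ (M.single-π A)) (F-idTo (M.single A))
      ; ⟦_⟧f      = λ g → F₁ (M.⟦ g ⟧f)
      }
      where
        module M = Interpretation M
        open FPFunctor F
        F-idTo : ∀ {X Y} (p : X ≡ Y) → F₁ (C.idTo p) E.≈ E.idTo (cong F₀ p)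
        F-idTo refl = identity

  -- C is free on σ via i: for every finite product category E′, the functor
  -- (- ∘ i) : FPFun(C, E′) → Int(σ, E′) is an isomorphism of categories,
  -- i.e. bijective on objects and bijective on each hom-set.

  module _ {o ℓ e} (C : FPCat o ℓ e) (i : Interpretation (FPCat.cat C)) where
    private
      module C = Category (FPCat.cat C)
      module i = Interpretation i

    record PrecompIso {o′ ℓ′ e′} (E : FPCat o′ ℓ′ e′) : Set (s ⊔ f ⊔ o ⊔ ℓ ⊔ e ⊔ lsuc (o′ ⊔ ℓ′ ⊔ e′)) where
      private
        E′ = FPCat.cat E
        module E′ = Category E′
      field
        obj-surj : (M : Interpretation E′) →
                   Σ (FPFunctor (FPCat.cat C) E′) λ F → _≐_ E′ (F ∘I i) M
        obj-inj  : (F G : FPFunctor (FPCat.cat C) E′) →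
                   _≐_ E′ (F ∘I i) (G ∘I i) → _≐F_ (FPCat.cat C) E′ F G
        hom-surj : (F G : FPFunctor (FPCat.cat C) E′)
                   (α : Homomorphism E′ (F ∘I i) (G ∘I i)) →
                   Σ (NatTrans (FPCat.cat C) E′ F G) λ β →
                     (A : Sort) → NatTrans.η β (i.⟦ A ⟧) E′.≈ Homomorphism.α α A
        hom-inj  : (F G : FPFunctor (FPCat.cat C) E′)
                   (β γ : NatTrans (FPCat.cat C) E′ F G) →
                   ((A : Sort) → NatTrans.η β (i.⟦ A ⟧) E′.≈ NatTrans.η γ (i.⟦ A ⟧)) →
                   (X : C.Obj) → NatTrans.η β X E′.≈ NatTrans.η γ X

    IsFree : Setω
    IsFree = ∀ {o′ ℓ′ e′} (E : FPCat o′ ℓ′ e′) → PrecompIso E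

record TwoCategory (o ℓ t e : Level) : Set (lsuc (o ⊔ ℓ ⊔ t ⊔ e)) where
  infix  4 _≈₂_ _⇒₁_ _⇒₂_
  infixr 9 _∘₁_ _∘ᵥ_ _∘ₕ_
  field
    Obj  : Set o
    _⇒₁_ : Obj → Obj → Set ℓ
    _⇒₂_ : ∀ {A B} → A ⇒₁ B → A ⇒₁ B → Set t
    _≈₂_ : ∀ {A B} {f g : A ⇒₁ B} → f ⇒₂ g → f ⇒₂ g → Set e
    ≈₂-equiv : ∀ {A B} {f g : A ⇒₁ B} → IsEquivalence (_≈₂_ {A} {B} {f} {g})

    id₁  : ∀ {A} → A ⇒₁ A
    _∘₁_ : ∀ {A B C} → B ⇒₁ C → A ⇒₁ B → A ⇒₁ C
    id₂  : ∀ {A B} {f : A ⇒₁ B} → f ⇒₂ f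
    _∘ᵥ_ : ∀ {A B} {f g h : A ⇒₁ B} → g ⇒₂ h → f ⇒₂ g → f ⇒₂ h
    _∘ₕ_ : ∀ {A B C} {f f′ : B ⇒₁ C} {g g′ : A ⇒₁ B} →
           f ⇒₂ f′ → g ⇒₂ g′ → f ∘₁ g ⇒₂ f′ ∘₁ g′

    assoc₁     : ∀ {A B C D} {f : A ⇒₁ B} {g : B ⇒₁ C} {h : C ⇒₁ D} →
                 (h ∘₁ g) ∘₁ f ≡ h ∘₁ (g ∘₁ f)
    identityˡ₁ : ∀ {A B} {f : A ⇒₁ B} → id₁ ∘₁ f ≡ f
    identityʳ₁ : ∀ {A B} {f : A ⇒₁ B} → f ∘₁ id₁ ≡ f

    ∘ᵥ-resp-≈  : ∀ {A B} {f g h : A ⇒₁ B} {α α′ : g ⇒₂ h} {β β′ : f ⇒₂ g} →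
                 α ≈₂ α′ → β ≈₂ β′ → α ∘ᵥ β ≈₂ α′ ∘ᵥ β′
    assocᵥ     : ∀ {A B} {f g h k : A ⇒₁ B} {α : f ⇒₂ g} {β : g ⇒₂ h} {γ : h ⇒₂ k} →
                 (γ ∘ᵥ β) ∘ᵥ α ≈₂ γ ∘ᵥ (β ∘ᵥ α)
    identityˡᵥ : ∀ {A B} {f g : A ⇒₁ B} {α : f ⇒₂ g} → id₂ ∘ᵥ α ≈₂ α
    identityʳᵥ : ∀ {A B} {f g : A ⇒₁ B} {α : f ⇒₂ g} → α ∘ᵥ id₂ ≈₂ α

    ∘ₕ-resp-≈   : ∀ {A B C} {f f′ : B ⇒₁ C} {g g′ : A ⇒₁ B} {α α′ : f ⇒₂ f′} {β β′ : g ⇒₂ g′} →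
                  α ≈₂ α′ → β ≈₂ β′ → α ∘ₕ β ≈₂ α′ ∘ₕ β′
    ∘ₕ-id       : ∀ {A B C} {f : B ⇒₁ C} {g : A ⇒₁ B} → id₂ {f = f} ∘ₕ id₂ {f = g} ≈₂ id₂
    interchange : ∀ {A B C} {f f′ f″ : B ⇒₁ C} {g g′ g″ : A ⇒₁ B}
                  {α : f ⇒₂ f′} {α′ : f′ ⇒₂ f″} {β : g ⇒₂ g′} {β′ : g′ ⇒₂ g″} →
                  (α′ ∘ᵥ α) ∘ₕ (β′ ∘ᵥ β) ≈₂ (α′ ∘ₕ β′) ∘ᵥ (α ∘ₕ β)

    -- strict associativity and unit laws for horizontal composition
    -- (the two sides live over 1-cells that are equal by assoc₁ / identity₁,
    --  so they are compared after transport)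
    assocₕ     : ∀ {A B C D} {f f′ : A ⇒₁ B} {g g′ : B ⇒₁ C} {h h′ : C ⇒₁ D}
                 {α : f ⇒₂ f′} {β : g ⇒₂ g′} {γ : h ⇒₂ h′} →
                 subst (λ k → (h′ ∘₁ g′) ∘₁ f′ ⇒₂ k) assoc₁ id₂ ∘ᵥ ((γ ∘ₕ β) ∘ₕ α)
                   ≈₂ (γ ∘ₕ (β ∘ₕ α)) ∘ᵥ subst (λ k → (h ∘₁ g) ∘₁ f ⇒₂ k) assoc₁ id₂
    identityˡₕ : ∀ {A B} {f f′ : A ⇒₁ B} {α : f ⇒₂ f′} →
                 subst (λ k → id₁ ∘₁ f′ ⇒₂ k) identityˡ₁ id₂ ∘ᵥ (id₂ {f = id₁} ∘ₕ α)
                   ≈₂ α ∘ᵥ subst (λ k → id₁ ∘₁ f ⇒₂ k) identityˡ₁ id₂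
    identityʳₕ : ∀ {A B} {f f′ : A ⇒₁ B} {α : f ⇒₂ f′} →
                 subst (λ k → f′ ∘₁ id₁ ⇒₂ k) identityʳ₁ id₂ ∘ᵥ (α ∘ₕ id₂ {f = id₁})
                   ≈₂ α ∘ᵥ subst (λ k → f ∘₁ id₁ ⇒₂ k) identityʳ₁ id₂

  idTo₂ : ∀ {A B} {f g : A ⇒₁ B} → f ≡ g → f ⇒₂ g
  idTo₂ {f = f} p = subst (λ k → f ⇒₂ k) p id₂

  IsIso₂ : ∀ {A B} {f g : A ⇒₁ B} → f ⇒₂ g → Set (t ⊔ e)
  IsIso₂ {f = f} {g} α = Σ (g ⇒₂ f) λ β → (β ∘ᵥ α ≈₂ id₂) × (α ∘ᵥ β ≈₂ id₂)

  IsEquivalence₁ : ∀ {A B} → A ⇒₁ B → Set (ℓ ⊔ t ⊔ e)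
  IsEquivalence₁ {A} {B} f =
    Σ (B ⇒₁ A) λ g →
      (Σ (g ∘₁ f ⇒₂ id₁) IsIso₂) × (Σ (f ∘₁ g ⇒₂ id₁) IsIso₂)

  underlying : Category o ℓ ℓ
  underlying = record
    { Obj       = Obj
    ; _⇒_       = _⇒₁_
    ; _≈_       = _≡_
    ; id        = id₁
    ; _∘_       = _∘₁_
    ; ≈-equiv   = isEquivalence
    ; ∘-resp-≈  = cong₂ _∘₁_
    ; assoc     = assoc₁
    ; identityˡ = identityˡ₁
    ; identityʳ = identityʳ₁
    }

  private module U = Category underlying

  -- 2-categorical products: a product in the underlying category such that for
  -- every Q the functor HOM(Q, P) → Π_i HOM(Q, X i), u ↦ (π i ∘ u)_i, is an
  -- isomorphism of categories (bijective on objects and on hom-sets)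
  record Is2Product {n : _} (X : Fin n → Obj) (P : Obj) (π : (i : Fin n) → P ⇒₁ X i)
         : Set (o ⊔ ℓ ⊔ t ⊔ e) where
    field
      isProduct : U.IsProduct X P π
      obj-surj  : ∀ {Q} (u : (i : Fin n) → Q ⇒₁ X i) →
                  Σ (Q ⇒₁ P) λ v → (i : Fin n) → π i ∘₁ v ≡ u i
      obj-inj   : ∀ {Q} (u v : Q ⇒₁ P) → ((i : Fin n) → π i ∘₁ u ≡ π i ∘₁ v) → u ≡ v
      hom-surj  : ∀ {Q} {u v : Q ⇒₁ P} (θ : (i : Fin n) → π i ∘₁ u ⇒₂ π i ∘₁ v) →
                  Σ (u ⇒₂ v) λ φ → (i : Fin n) → id₂ {f = π i} ∘ₕ φ ≈₂ θ i
      hom-inj   : ∀ {Q} {u v : Q ⇒₁ P} (φ ψ : u ⇒₂ v) →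
                  ((i : Fin n) → id₂ {f = π i} ∘ₕ φ ≈₂ id₂ {f = π i} ∘ₕ ψ) → φ ≈₂ ψ

  record TwoProduct {n : _} (X : Fin n → Obj) : Set (o ⊔ ℓ ⊔ t ⊔ e) where
    field
      P           : Obj
      π           : (i : Fin n) → P ⇒₁ X i
      is2Product  : Is2Product X P π

  HasFinite2Products : Set (o ⊔ ℓ ⊔ t ⊔ e)
  HasFinite2Products = (n : _) (X : Fin n → Obj) → TwoProduct X

module _ {o ℓ e o′ ℓ′ t′ e′} {C : Category o ℓ e} (D : TwoCategory o′ ℓ′ t′ e′) where
  private
    module C = Category C
  open TwoCategory D

  record PseudoNat (F G : FPFunctor C (underlying)) : Set (o ⊔ ℓ ⊔ e ⊔ ℓ′ ⊔ t′ ⊔ e′) where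
    private
      module F = FPFunctor F
      module G = FPFunctor G
    field
      β₁     : (X : C.Obj) → F.F₀ X ⇒₁ G.F₀ X
      β₂     : ∀ {X Y} (f : X C.⇒ Y) → β₁ Y ∘₁ F.F₁ f ⇒₂ G.F₁ f ∘₁ β₁ X
      β₂-iso : ∀ {X Y} (f : X C.⇒ Y) → IsIso₂ (β₂ f)
      -- well-defined on equivalence classes of morphisms of C
      β₂-resp : ∀ {X Y} {f g : X C.⇒ Y} (p : f C.≈ g) →
                idTo₂ (cong (_∘₁ β₁ X) (G.F-resp-≈ p)) ∘ᵥ β₂ f
                  ≈₂ β₂ g ∘ᵥ idTo₂ (cong (β₁ Y ∘₁_) (F.F-resp-≈ p))
      β₂-comp : ∀ {X Y Z} (f : X C.⇒ Y) (g : Y C.⇒ Z) →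
                (id₂ {f = G.F₁ g} ∘ₕ β₂ f) ∘ᵥ idTo₂ assoc₁ ∘ᵥ (β₂ g ∘ₕ id₂ {f = F.F₁ f})
                  ∘ᵥ idTo₂ (trans (cong (β₁ Z ∘₁_) F.homomorphism) (sym assoc₁))
                ≈₂ idTo₂ (trans (cong (_∘₁ β₁ X) G.homomorphism) assoc₁) ∘ᵥ β₂ (g C.∘ f)
      β₂-id  : ∀ {X} →
               idTo₂ (trans (cong (_∘₁ β₁ X) G.identity) identityˡ₁) ∘ᵥ β₂ (C.id {X})
                 ≈₂ idTo₂ (trans (cong (β₁ X ∘₁_) F.identity) identityʳ₁)

  PseudonaturallyEquivalent : (F G : FPFunctor C underlying) → Set (o ⊔ ℓ ⊔ e ⊔ ℓ′ ⊔ t′ ⊔ e′)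
  PseudonaturallyEquivalent F G =
    Σ (PseudoNat F G) λ β → (X : C.Obj) → IsEquivalence₁ (PseudoNat.β₁ β X)

module _ {s f o ℓ t e} (σ : Signature s f) (D : TwoCategory o ℓ t e) where
  open Signature σ
  open TwoCategory D

  record HomotopyHom (M N : Interpretation σ underlying) : Set (s ⊔ f ⊔ o ⊔ ℓ ⊔ t ⊔ e) where
    private
      module M = Interpretation M
      module N = Interpretation N
    field
      α₁     : (A : Sort) → M.⟦ A ⟧ ⇒₁ N.⟦ A ⟧
      α₂     : ∀ {As B} (g : Fun As B) → α₁ B ∘₁ M.⟦ g ⟧f ⇒₂ N.⟦ g ⟧f ∘₁ ×map σ underlying M N α₁ As
      α₂-iso : ∀ {As B} (g : Fun As B) → IsIso₂ (α₂ g)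

  HomotopyEquivalent : (M N : Interpretation σ underlying) → Set (s ⊔ f ⊔ o ⊔ ℓ ⊔ t ⊔ e)
  HomotopyEquivalent M N =
    Σ (HomotopyHom M N) λ α → (A : Sort) → IsEquivalence₁ (HomotopyHom.α₁ α A)

-- Pseudonatural ⇒ homotopy: restricting a pseudonatural equivalence β along i gives
-- equivalences β_A and, for each operation g, the cell β_{i g} followed by the
-- comparison between β at the product i A⃗ and the product of the β_{A_j}; that
-- comparison exists and is invertible by the 2-dimensional universal property of
-- the products of D, applied to the (inverted) cells β_{π_j}.
--
-- Homotopy ⇒ pseudonatural: equivalences of D and squares commuting up to an
-- invertible 2-cell form a finite product category (products are computed
-- componentwise via 2-products), in which a homotopy equivalence α : M → N is
-- exactly an interpretation of σ. Freeness lifts it to an f.p. functor F from C;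
-- the domain and codomain projections of F restrict along i to M and N, so they
-- are M̃ and Ñ, and the arrows of F together with their square cells form the
-- required pseudonatural equivalence.

module Submission where

open import Level using (_⊔_)
open import Data.Fin using (Fin; zero)
open import Data.List using (List; []; _∷_; length; lookup)
open import Data.Product using (Σ; _,_; proj₁; proj₂)
open import Function.Bundles using (_⇔_; mk⇔)
open import Relation.Binary.PropositionalEquality
open import Relation.Binary.Structures using (IsEquivalence)
open import Defs

module TwoCells {o ℓ t e} (D : TwoCategory o ℓ t e) where
  open TwoCategory D

  private
    module ≈₂ {A B} {f g : A ⇒₁ B} = IsEquivalence (≈₂-equiv {A} {B} {f} {g})

  refl₂ : ∀ {A B} {f g : A ⇒₁ B} {α : f ⇒₂ g} → α ≈₂ α
  refl₂ = ≈₂.refl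

  sym₂ : ∀ {A B} {f g : A ⇒₁ B} {α β : f ⇒₂ g} → α ≈₂ β → β ≈₂ α
  sym₂ = ≈₂.sym

  trans₂ : ∀ {A B} {f g : A ⇒₁ B} {α β γ : f ⇒₂ g} → α ≈₂ β → β ≈₂ γ → α ≈₂ γ
  trans₂ = ≈₂.trans

  cast : ∀ {A B} {f f′ g g′ : A ⇒₁ B} → f ≡ f′ → g ≡ g′ → f ⇒₂ g → f′ ⇒₂ g′
  cast refl refl α = α

  -- Since 1-cells are compared by _≡_, the strict laws of D only identify 2-cells
  -- after transport of their boundaries; _≅_ makes this transport implicit.
  infix 4 _≅_
  record _≅_ {A B} {f g f′ g′ : A ⇒₁ B} (α : f ⇒₂ g) (β : f′ ⇒₂ g′) : Set (ℓ ⊔ e) where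
    constructor mk≅
    field
      ≅-src  : f ≡ f′
      ≅-tgt  : g ≡ g′
      ≅-cast : cast ≅-src ≅-tgt α ≈₂ β
  open _≅_ public using (≅-src; ≅-tgt)

  ≈⇒≅ : ∀ {A B} {f g : A ⇒₁ B} {α β : f ⇒₂ g} → α ≈₂ β → α ≅ β
  ≈⇒≅ x = mk≅ refl refl x

  ≅⇒≈ : ∀ {A B} {f g : A ⇒₁ B} {α β : f ⇒₂ g} → α ≅ β → α ≈₂ β
  ≅⇒≈ (mk≅ refl refl x) = x

  ≅-refl : ∀ {A B} {f g : A ⇒₁ B} {α : f ⇒₂ g} → α ≅ α
  ≅-refl = mk≅ refl refl refl₂

  ≅-sym : ∀ {A B} {f g f′ g′ : A ⇒₁ B} {α : f ⇒₂ g} {β : f′ ⇒₂ g′} → α ≅ β → β ≅ α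
  ≅-sym (mk≅ refl refl x) = mk≅ refl refl (sym₂ x)

  ≅-trans : ∀ {A B} {f g f′ g′ f″ g″ : A ⇒₁ B} {α : f ⇒₂ g} {β : f′ ⇒₂ g′} {γ : f″ ⇒₂ g″} →
            α ≅ β → β ≅ γ → α ≅ γ
  ≅-trans (mk≅ refl refl x) (mk≅ refl refl y) = mk≅ refl refl (trans₂ x y)

  module ≅-Reasoning where
    infix  3 _∎
    infixr 2 _≅⟨_⟩_ _≈⟨_⟩_
    infix  1 begin_

    begin_ : ∀ {A B} {f g f′ g′ : A ⇒₁ B} {α : f ⇒₂ g} {β : f′ ⇒₂ g′} → α ≅ β → α ≅ β
    begin x = x

    _≅⟨_⟩_ : ∀ {A B} {f g f′ g′ f″ g″ : A ⇒₁ B} (α : f ⇒₂ g) {β : f′ ⇒₂ g′} {γ : f″ ⇒₂ g″} →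
              α ≅ β → β ≅ γ → α ≅ γ
    α ≅⟨ x ⟩ y = ≅-trans x y

    _≈⟨_⟩_ : ∀ {A B} {f g f″ g″ : A ⇒₁ B} (α : f ⇒₂ g) {β : f ⇒₂ g} {γ : f″ ⇒₂ g″} →
              α ≈₂ β → β ≅ γ → α ≅ γ
    α ≈⟨ x ⟩ y = ≅-trans (≈⇒≅ x) y

    _∎ : ∀ {A B} {f g : A ⇒₁ B} (α : f ⇒₂ g) → α ≅ α
    α ∎ = ≅-refl

  open ≅-Reasoning

  cast≅ : ∀ {A B} {f f′ g g′ : A ⇒₁ B} (p : f ≡ f′) (q : g ≡ g′) (α : f ⇒₂ g) → cast p q α ≅ α
  cast≅ refl refl α = ≅-refl

  idTo₂≅ : ∀ {A B} {f g : A ⇒₁ B} (p : f ≡ g) → idTo₂ p ≅ id₂ {f = f}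
  idTo₂≅ refl = ≅-refl

  id₂-≅ : ∀ {A B} {f g : A ⇒₁ B} → f ≡ g → id₂ {f = f} ≅ id₂ {f = g}
  id₂-≅ refl = ≅-refl

  ∘ᵥ-≅ : ∀ {A B} {f g h f′ g′ h′ : A ⇒₁ B} {α : g ⇒₂ h} {β : f ⇒₂ g} {α′ : g′ ⇒₂ h′} {β′ : f′ ⇒₂ g′} →
         α ≅ α′ → β ≅ β′ → α ∘ᵥ β ≅ α′ ∘ᵥ β′
  ∘ᵥ-≅ (mk≅ refl refl x) (mk≅ refl refl y) = mk≅ refl refl (∘ᵥ-resp-≈ x y)

  ∘ₕ-≅ : ∀ {A B C} {f f′ h h′ : B ⇒₁ C} {g g′ k k′ : A ⇒₁ B}
         {α : f ⇒₂ f′} {β : g ⇒₂ g′} {α′ : h ⇒₂ h′} {β′ : k ⇒₂ k′} →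
         α ≅ α′ → β ≅ β′ → α ∘ₕ β ≅ α′ ∘ₕ β′
  ∘ₕ-≅ (mk≅ refl refl x) (mk≅ refl refl y) = mk≅ refl refl (∘ₕ-resp-≈ x y)

  identityˡᵥ≅ : ∀ {A B} {f g : A ⇒₁ B} {α : f ⇒₂ g} → id₂ ∘ᵥ α ≅ α
  identityˡᵥ≅ = ≈⇒≅ identityˡᵥ

  identityʳᵥ≅ : ∀ {A B} {f g : A ⇒₁ B} {α : f ⇒₂ g} → α ∘ᵥ id₂ ≅ α
  identityʳᵥ≅ = ≈⇒≅ identityʳᵥ

  assocᵥ≅ : ∀ {A B} {f g h k : A ⇒₁ B} {α : f ⇒₂ g} {β : g ⇒₂ h} {γ : h ⇒₂ k} →
            (γ ∘ᵥ β) ∘ᵥ α ≅ γ ∘ᵥ (β ∘ᵥ α)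
  assocᵥ≅ = ≈⇒≅ assocᵥ

  assocᵥ⁵ : ∀ {A B} {x0 x1 x2 x3 x4 x5 x6 : A ⇒₁ B}
            {a : x4 ⇒₂ x5} {b : x3 ⇒₂ x4} {c : x2 ⇒₂ x3} {d : x1 ⇒₂ x2} {f : x0 ⇒₂ x1} {g : x6 ⇒₂ x0} →
            (a ∘ᵥ (b ∘ᵥ (c ∘ᵥ (d ∘ᵥ f)))) ∘ᵥ g ≅ a ∘ᵥ (b ∘ᵥ (c ∘ᵥ (d ∘ᵥ (f ∘ᵥ g))))
  assocᵥ⁵ = ≅-trans assocᵥ≅ (∘ᵥ-≅ ≅-refl (≅-trans assocᵥ≅ (∘ᵥ-≅ ≅-refl (≅-trans assocᵥ≅ (∘ᵥ-≅ ≅-refl assocᵥ≅)))))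

  idTo₂-absorbˡ : ∀ {A B} {f g h : A ⇒₁ B} (p : g ≡ h) {α : f ⇒₂ g} → idTo₂ p ∘ᵥ α ≅ α
  idTo₂-absorbˡ refl = identityˡᵥ≅

  idTo₂-absorbʳ : ∀ {A B} {f g h : A ⇒₁ B} (p : f ≡ g) {α : g ⇒₂ h} → α ∘ᵥ idTo₂ p ≅ α
  idTo₂-absorbʳ refl = identityʳᵥ≅

  assocₕ≅ : ∀ {A B C D} {f f′ : A ⇒₁ B} {g g′ : B ⇒₁ C} {h h′ : C ⇒₁ D}
            {α : f ⇒₂ f′} {β : g ⇒₂ g′} {γ : h ⇒₂ h′} →
            (γ ∘ₕ β) ∘ₕ α ≅ γ ∘ₕ (β ∘ₕ α)
  assocₕ≅ = ≅-trans (≅-sym (idTo₂-absorbˡ assoc₁)) (≅-trans (≈⇒≅ assocₕ) (idTo₂-absorbʳ assoc₁))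

  identityˡₕ≅ : ∀ {A B} {f f′ : A ⇒₁ B} {α : f ⇒₂ f′} → id₂ {f = id₁} ∘ₕ α ≅ α
  identityˡₕ≅ = ≅-trans (≅-sym (idTo₂-absorbˡ identityˡ₁)) (≅-trans (≈⇒≅ identityˡₕ) (idTo₂-absorbʳ identityˡ₁))

  identityʳₕ≅ : ∀ {A B} {f f′ : A ⇒₁ B} {α : f ⇒₂ f′} → α ∘ₕ id₂ {f = id₁} ≅ α
  identityʳₕ≅ = ≅-trans (≅-sym (idTo₂-absorbˡ identityʳ₁)) (≅-trans (≈⇒≅ identityʳₕ) (idTo₂-absorbʳ identityʳ₁))

  ∘ₕ-id≅ : ∀ {A B C} {f : B ⇒₁ C} {g : A ⇒₁ B} → id₂ {f = f} ∘ₕ id₂ {f = g} ≅ id₂ {f = f ∘₁ g}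
  ∘ₕ-id≅ = ≈⇒≅ ∘ₕ-id

  interchange≅ : ∀ {A B C} {f f′ f″ : B ⇒₁ C} {g g′ g″ : A ⇒₁ B}
                 {α : f ⇒₂ f′} {α′ : f′ ⇒₂ f″} {β : g ⇒₂ g′} {β′ : g′ ⇒₂ g″} →
                 (α′ ∘ᵥ α) ∘ₕ (β′ ∘ᵥ β) ≅ (α′ ∘ₕ β′) ∘ᵥ (α ∘ₕ β)
  interchange≅ = ≈⇒≅ interchange

  whiskerˡ-∘ᵥ : ∀ {A B C} {h : B ⇒₁ C} {f g k : A ⇒₁ B} {α : g ⇒₂ k} {β : f ⇒₂ g} →
                id₂ {f = h} ∘ₕ (α ∘ᵥ β) ≅ (id₂ {f = h} ∘ₕ α) ∘ᵥ (id₂ ∘ₕ β)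
  whiskerˡ-∘ᵥ = ≅-trans (∘ₕ-≅ (≅-sym identityˡᵥ≅) ≅-refl) interchange≅

  whiskerʳ-∘ᵥ : ∀ {A B C} {h : A ⇒₁ B} {f g k : B ⇒₁ C} {α : g ⇒₂ k} {β : f ⇒₂ g} →
                (α ∘ᵥ β) ∘ₕ id₂ {f = h} ≅ (α ∘ₕ id₂ {f = h}) ∘ᵥ (β ∘ₕ id₂)
  whiskerʳ-∘ᵥ = ≅-trans (∘ₕ-≅ ≅-refl (≅-sym identityˡᵥ≅)) interchange≅

  whiskerʳ-∘ᵥ⁴ : ∀ {A B C} {h : A ⇒₁ B} {x0 x1 x2 x3 x4 : B ⇒₁ C}
                 {a : x3 ⇒₂ x4} {b : x2 ⇒₂ x3} {c : x1 ⇒₂ x2} {d : x0 ⇒₂ x1} →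
                 (a ∘ᵥ (b ∘ᵥ (c ∘ᵥ d))) ∘ₕ id₂ {f = h} ≅
                 (a ∘ₕ id₂) ∘ᵥ ((b ∘ₕ id₂) ∘ᵥ ((c ∘ₕ id₂) ∘ᵥ (d ∘ₕ id₂)))
  whiskerʳ-∘ᵥ⁴ = ≅-trans whiskerʳ-∘ᵥ (∘ᵥ-≅ ≅-refl (≅-trans whiskerʳ-∘ᵥ (∘ᵥ-≅ ≅-refl whiskerʳ-∘ᵥ)))

  whiskerˡ-∘ᵥ⁴ : ∀ {A B C} {h : B ⇒₁ C} {x0 x1 x2 x3 x4 : A ⇒₁ B}
                 {a : x3 ⇒₂ x4} {b : x2 ⇒₂ x3} {c : x1 ⇒₂ x2} {d : x0 ⇒₂ x1} →
                 id₂ {f = h} ∘ₕ (a ∘ᵥ (b ∘ᵥ (c ∘ᵥ d))) ≅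
                 (id₂ ∘ₕ a) ∘ᵥ ((id₂ ∘ₕ b) ∘ᵥ ((id₂ ∘ₕ c) ∘ᵥ (id₂ ∘ₕ d)))
  whiskerˡ-∘ᵥ⁴ = ≅-trans whiskerˡ-∘ᵥ (∘ᵥ-≅ ≅-refl (≅-trans whiskerˡ-∘ᵥ (∘ᵥ-≅ ≅-refl whiskerˡ-∘ᵥ)))

  whiskerʳ-∘ᵥ⁵ : ∀ {A B C} {h : A ⇒₁ B} {x0 x1 x2 x3 x4 x5 : B ⇒₁ C}
                 {a : x4 ⇒₂ x5} {b : x3 ⇒₂ x4} {c : x2 ⇒₂ x3} {d : x1 ⇒₂ x2} {f : x0 ⇒₂ x1} →
                 (a ∘ᵥ (b ∘ᵥ (c ∘ᵥ (d ∘ᵥ f)))) ∘ₕ id₂ {f = h} ≅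
                 (a ∘ₕ id₂) ∘ᵥ ((b ∘ₕ id₂) ∘ᵥ ((c ∘ₕ id₂) ∘ᵥ ((d ∘ₕ id₂) ∘ᵥ (f ∘ₕ id₂))))
  whiskerʳ-∘ᵥ⁵ = ≅-trans whiskerʳ-∘ᵥ (∘ᵥ-≅ ≅-refl whiskerʳ-∘ᵥ⁴)

  whiskerˡ-∘ᵥ⁵ : ∀ {A B C} {h : B ⇒₁ C} {x0 x1 x2 x3 x4 x5 : A ⇒₁ B}
                 {a : x4 ⇒₂ x5} {b : x3 ⇒₂ x4} {c : x2 ⇒₂ x3} {d : x1 ⇒₂ x2} {f : x0 ⇒₂ x1} →
                 id₂ {f = h} ∘ₕ (a ∘ᵥ (b ∘ᵥ (c ∘ᵥ (d ∘ᵥ f)))) ≅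
                 (id₂ ∘ₕ a) ∘ᵥ ((id₂ ∘ₕ b) ∘ᵥ ((id₂ ∘ₕ c) ∘ᵥ ((id₂ ∘ₕ d) ∘ᵥ (id₂ ∘ₕ f))))
  whiskerˡ-∘ᵥ⁵ = ≅-trans whiskerˡ-∘ᵥ (∘ᵥ-≅ ≅-refl whiskerˡ-∘ᵥ⁴)

  whiskerˡ-whiskerˡ : ∀ {A B C E} {f : C ⇒₁ E} {g : B ⇒₁ C} {h k : A ⇒₁ B} {α : h ⇒₂ k} →
                      id₂ {f = f} ∘ₕ (id₂ {f = g} ∘ₕ α) ≅ id₂ {f = f ∘₁ g} ∘ₕ α
  whiskerˡ-whiskerˡ = ≅-trans (≅-sym assocₕ≅) (∘ₕ-≅ ∘ₕ-id≅ ≅-refl)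

  iso-id : ∀ {A B} {f : A ⇒₁ B} → IsIso₂ (id₂ {f = f})
  iso-id = id₂ , identityˡᵥ , identityˡᵥ

  iso-idTo : ∀ {A B} {f g : A ⇒₁ B} (p : f ≡ g) → IsIso₂ (idTo₂ p)
  iso-idTo refl = iso-id

  iso-cast : ∀ {A B} {f f′ g g′ : A ⇒₁ B} (p : f ≡ f′) (q : g ≡ g′) {α : f ⇒₂ g} →
             IsIso₂ α → IsIso₂ (cast p q α)
  iso-cast refl refl i = i

  iso-inv : ∀ {A B} {f g : A ⇒₁ B} {α : f ⇒₂ g} (i : IsIso₂ α) → IsIso₂ (proj₁ i)
  iso-inv {α = α} (_ , l , r) = α , r , l

  iso-∘ᵥ : ∀ {A B} {f g h : A ⇒₁ B} {α : g ⇒₂ h} {β : f ⇒₂ g} →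
           IsIso₂ α → IsIso₂ β → IsIso₂ (α ∘ᵥ β)
  iso-∘ᵥ {α = α} {β} (a , al , ar) (b , bl , br) = (b ∘ᵥ a) , ≅⇒≈ left , ≅⇒≈ right
    where
    left = begin
      (b ∘ᵥ a) ∘ᵥ (α ∘ᵥ β)   ≅⟨ assocᵥ≅ ⟩
      b ∘ᵥ (a ∘ᵥ (α ∘ᵥ β))   ≅⟨ ∘ᵥ-≅ ≅-refl (≅-sym assocᵥ≅) ⟩
      b ∘ᵥ ((a ∘ᵥ α) ∘ᵥ β)   ≅⟨ ∘ᵥ-≅ ≅-refl (∘ᵥ-≅ (≈⇒≅ al) ≅-refl) ⟩
      b ∘ᵥ (id₂ ∘ᵥ β)        ≅⟨ ∘ᵥ-≅ ≅-refl identityˡᵥ≅ ⟩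
      b ∘ᵥ β                 ≈⟨ bl ⟩
      id₂                    ∎
    right = begin
      (α ∘ᵥ β) ∘ᵥ (b ∘ᵥ a)   ≅⟨ assocᵥ≅ ⟩
      α ∘ᵥ (β ∘ᵥ (b ∘ᵥ a))   ≅⟨ ∘ᵥ-≅ ≅-refl (≅-sym assocᵥ≅) ⟩
      α ∘ᵥ ((β ∘ᵥ b) ∘ᵥ a)   ≅⟨ ∘ᵥ-≅ ≅-refl (∘ᵥ-≅ (≈⇒≅ br) ≅-refl) ⟩
      α ∘ᵥ (id₂ ∘ᵥ a)        ≅⟨ ∘ᵥ-≅ ≅-refl identityˡᵥ≅ ⟩
      α ∘ᵥ a                 ≈⟨ ar ⟩
      id₂                    ∎

  iso-∘ₕ : ∀ {A B C} {f f′ : B ⇒₁ C} {g g′ : A ⇒₁ B} {α : f ⇒₂ f′} {β : g ⇒₂ g′} →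
           IsIso₂ α → IsIso₂ β → IsIso₂ (α ∘ₕ β)
  iso-∘ₕ (a , al , ar) (b , bl , br) = (a ∘ₕ b) ,
    ≅⇒≈ (≅-trans (≅-sym interchange≅) (≅-trans (∘ₕ-≅ (≈⇒≅ al) (≈⇒≅ bl)) ∘ₕ-id≅)) ,
    ≅⇒≈ (≅-trans (≅-sym interchange≅) (≅-trans (∘ₕ-≅ (≈⇒≅ ar) (≈⇒≅ br)) ∘ₕ-id≅))

  iso-whisker : ∀ {A B C E} {h : C ⇒₁ E} {k : A ⇒₁ B} {f g : B ⇒₁ C} {α : f ⇒₂ g} →
                IsIso₂ α → IsIso₂ (id₂ {f = h} ∘ₕ (α ∘ₕ id₂ {f = k}))
  iso-whisker i = iso-∘ₕ iso-id (iso-∘ₕ i iso-id)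

  IsId₂ : ∀ {A B} {f g : A ⇒₁ B} → f ⇒₂ g → Set (ℓ ⊔ e)
  IsId₂ {f = f} α = α ≅ id₂ {f = f}

  isId-id : ∀ {A B} {f : A ⇒₁ B} → IsId₂ (id₂ {f = f})
  isId-id = ≅-refl

  isId-idTo : ∀ {A B} {f g : A ⇒₁ B} (p : f ≡ g) → IsId₂ (idTo₂ p)
  isId-idTo = idTo₂≅

  isId-cast : ∀ {A B} {f f′ g g′ : A ⇒₁ B} (p : f ≡ f′) (q : g ≡ g′) {α : f ⇒₂ g} →
              IsId₂ α → IsId₂ (cast p q α)
  isId-cast refl refl x = x

  isId-∘ᵥ : ∀ {A B} {f g h : A ⇒₁ B} {α : g ⇒₂ h} {β : f ⇒₂ g} → IsId₂ α → IsId₂ β → IsId₂ (α ∘ᵥ β)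
  isId-∘ᵥ (mk≅ refl refl x) (mk≅ refl refl y) = ≈⇒≅ (trans₂ (∘ᵥ-resp-≈ x y) identityˡᵥ)

  isId-∘ₕ : ∀ {A B C} {f f′ : B ⇒₁ C} {g g′ : A ⇒₁ B} {α : f ⇒₂ f′} {β : g ⇒₂ g′} →
            IsId₂ α → IsId₂ β → IsId₂ (α ∘ₕ β)
  isId-∘ₕ x y = ≅-trans (∘ₕ-≅ x y) ∘ₕ-id≅

  isId-idTo-whiskerʳ : ∀ {A B C} {h : A ⇒₁ B} {f g : B ⇒₁ C} (p : f ≡ g) →
                       IsId₂ (idTo₂ p ∘ₕ id₂ {f = h})
  isId-idTo-whiskerʳ p = isId-∘ₕ (isId-idTo p) isId-id

  isId-whiskerˡ-idTo : ∀ {A B C} {h : B ⇒₁ C} {f g : A ⇒₁ B} (p : f ≡ g) →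
                       IsId₂ (id₂ {f = h} ∘ₕ idTo₂ p)
  isId-whiskerˡ-idTo p = isId-∘ₕ isId-id (isId-idTo p)

  ≅-id₂⇒IsId₂ : ∀ {A B} {f g f′ : A ⇒₁ B} {α : f ⇒₂ g} → α ≅ id₂ {f = f′} → IsId₂ α
  ≅-id₂⇒IsId₂ x = ≅-trans x (id₂-≅ (sym (≅-src x)))

  isId-absorbʳ : ∀ {A B} {f g h : A ⇒₁ B} {α : g ⇒₂ h} {β : f ⇒₂ g} → IsId₂ β → α ∘ᵥ β ≅ α
  isId-absorbʳ (mk≅ refl refl y) = ≅-trans (∘ᵥ-≅ ≅-refl (≈⇒≅ y)) identityʳᵥ≅

  isId-absorbˡ : ∀ {A B} {f g h : A ⇒₁ B} {α : g ⇒₂ h} {β : f ⇒₂ g} → IsId₂ α → α ∘ᵥ β ≅ β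
  isId-absorbˡ (mk≅ refl refl y) = ≅-trans (∘ᵥ-≅ (≈⇒≅ y) ≅-refl) identityˡᵥ≅

  isId-≅-by-tgt : ∀ {A B} {x y x′ y′ : A ⇒₁ B} {α : x ⇒₂ y} {β : x′ ⇒₂ y′} →
                  IsId₂ α → IsId₂ β → y ≡ y′ → α ≅ β
  isId-≅-by-tgt (mk≅ refl refl x) (mk≅ refl refl y) refl = ≈⇒≅ (trans₂ x (sym₂ y))

  isId-≅-by-src : ∀ {A B} {x y x′ y′ : A ⇒₁ B} {α : x ⇒₂ y} {β : x′ ⇒₂ y′} →
                  IsId₂ α → IsId₂ β → x ≡ x′ → α ≅ β
  isId-≅-by-src (mk≅ refl refl x) (mk≅ refl refl y) refl = ≈⇒≅ (trans₂ x (sym₂ y))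

  isId-≈ : ∀ {A B} {x y : A ⇒₁ B} {α β : x ⇒₂ y} → IsId₂ α → IsId₂ β → α ≈₂ β
  isId-≈ a b = ≅⇒≈ (isId-≅-by-src a b refl)

module TwoProducts {o ℓ t e} (D : TwoCategory o ℓ t e) (has2 : TwoCategory.HasFinite2Products D) where
  open TwoCategory D
  open TwoCells D
  open ≅-Reasoning
  private module U = Category underlying

  -- A product of the underlying category is a retract of the chosen 2-product of
  -- the same factors, and the 2-dimensional universal property transfers along it.
  module _ {n} {X : Fin n → Obj} {P : Obj} {π : (i : Fin n) → P ⇒₁ X i}
           (isP : U.IsProduct X P π) where
    private
      open U.IsProduct isP
      module T = TwoProduct (has2 n X)
      module T2 = Is2Product T.is2Product

      section : P ⇒₁ T.P
      section = proj₁ (T2.obj-surj π)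

      section-commute : ∀ i → T.π i ∘₁ section ≡ π i
      section-commute = proj₂ (T2.obj-surj π)

      retraction : T.P ⇒₁ P
      retraction = ⟨ T.π ⟩

      retraction-commute : ∀ i → π i ∘₁ retraction ≡ T.π i
      retraction-commute = commute T.π

      retraction∘section : retraction ∘₁ section ≡ id₁
      retraction∘section =
        trans (unique π (retraction ∘₁ section)
                (λ i → trans (sym assoc₁) (trans (cong (_∘₁ section) (retraction-commute i))
                                                 (section-commute i))))
              (sym (unique π id₁ (λ i → identityʳ₁)))

      retraction∘section∘ : ∀ {Q} (a : Q ⇒₁ P) → retraction ∘₁ (section ∘₁ a) ≡ a
      retraction∘section∘ a = trans (sym assoc₁) (trans (cong (_∘₁ a) retraction∘section) identityˡ₁)

      π∘-via-section : ∀ {Q} (a : Q ⇒₁ P) i → π i ∘₁ a ≡ T.π i ∘₁ (section ∘₁ a)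
      π∘-via-section a i = trans (cong (_∘₁ a) (sym (section-commute i))) assoc₁

    2-hom-surj : ∀ {Q} {u v : Q ⇒₁ P} (θ : (i : Fin n) → π i ∘₁ u ⇒₂ π i ∘₁ v) →
                 Σ (u ⇒₂ v) λ φ → (i : Fin n) → id₂ {f = π i} ∘ₕ φ ≈₂ θ i
    2-hom-surj {u = u} {v} θ = φ , λ i → ≅⇒≈ (φ-commute i)
      where
      θ′ = λ i → cast (π∘-via-section u i) (π∘-via-section v i) (θ i)
      φ′ = proj₁ (T2.hom-surj θ′)
      φ = cast (retraction∘section∘ u) (retraction∘section∘ v) (id₂ {f = retraction} ∘ₕ φ′)
      φ-commute : ∀ i → id₂ {f = π i} ∘ₕ φ ≅ θ i
      φ-commute i = begin
        id₂ ∘ₕ φ                          ≅⟨ ∘ₕ-≅ ≅-refl (cast≅ _ _ _) ⟩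
        id₂ ∘ₕ (id₂ ∘ₕ φ′)                ≅⟨ whiskerˡ-whiskerˡ ⟩
        id₂ {f = π i ∘₁ retraction} ∘ₕ φ′ ≅⟨ ∘ₕ-≅ (id₂-≅ (retraction-commute i)) ≅-refl ⟩
        id₂ {f = T.π i} ∘ₕ φ′             ≈⟨ proj₂ (T2.hom-surj θ′) i ⟩
        θ′ i                              ≅⟨ cast≅ _ _ _ ⟩
        θ i                               ∎

    2-hom-inj : ∀ {Q} {u v : Q ⇒₁ P} (φ ψ : u ⇒₂ v) →
                ((i : Fin n) → id₂ {f = π i} ∘ₕ φ ≈₂ id₂ {f = π i} ∘ₕ ψ) → φ ≈₂ ψ
    2-hom-inj φ ψ h = ≅⇒≈ (begin
      φ                                    ≅⟨ ≅-sym identityˡₕ≅ ⟩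
      id₂ {f = id₁} ∘ₕ φ                   ≅⟨ ∘ₕ-≅ (id₂-≅ (sym retraction∘section)) ≅-refl ⟩
      id₂ {f = retraction ∘₁ section} ∘ₕ φ ≅⟨ ≅-sym whiskerˡ-whiskerˡ ⟩
      id₂ ∘ₕ (id₂ ∘ₕ φ)                    ≅⟨ ∘ₕ-≅ ≅-refl (≈⇒≅ section-whiskers) ⟩
      id₂ ∘ₕ (id₂ ∘ₕ ψ)                    ≅⟨ whiskerˡ-whiskerˡ ⟩
      id₂ {f = retraction ∘₁ section} ∘ₕ ψ ≅⟨ ∘ₕ-≅ (id₂-≅ retraction∘section) ≅-refl ⟩
      id₂ {f = id₁} ∘ₕ ψ                   ≅⟨ identityˡₕ≅ ⟩
      ψ                                    ∎)
      where
      section-whiskers : id₂ {f = section} ∘ₕ φ ≈₂ id₂ {f = section} ∘ₕ ψ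
      section-whiskers = T2.hom-inj _ _ λ i → ≅⇒≈ (begin
        id₂ ∘ₕ (id₂ ∘ₕ φ)               ≅⟨ whiskerˡ-whiskerˡ ⟩
        id₂ {f = T.π i ∘₁ section} ∘ₕ φ ≅⟨ ∘ₕ-≅ (id₂-≅ (section-commute i)) ≅-refl ⟩
        id₂ {f = π i} ∘ₕ φ              ≈⟨ h i ⟩
        id₂ {f = π i} ∘ₕ ψ              ≅⟨ ∘ₕ-≅ (id₂-≅ (sym (section-commute i))) ≅-refl ⟩
        id₂ {f = T.π i ∘₁ section} ∘ₕ ψ ≅⟨ ≅-sym whiskerˡ-whiskerˡ ⟩
        id₂ ∘ₕ (id₂ ∘ₕ ψ)               ∎)

    product⇒2-product : Is2Product X P π
    product⇒2-product = record
      { isProduct = isP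
      ; obj-surj  = λ u → ⟨ u ⟩ , commute u
      ; obj-inj   = λ u v h → trans (unique (λ i → π i ∘₁ v) u h)
                                    (sym (unique (λ i → π i ∘₁ v) v (λ i → refl)))
      ; hom-surj  = 2-hom-surj
      ; hom-inj   = 2-hom-inj
      }

  module _ {n} {X : Fin n → Obj} {P : Obj} {π : (i : Fin n) → P ⇒₁ X i}
           (is2 : Is2Product X P π) where
    open Is2Product is2

    inverse-by-components : ∀ {Q} {u v : Q ⇒₁ P} {φ : v ⇒₂ u} {ψ : u ⇒₂ v}
                            {θ : ∀ i → π i ∘₁ v ⇒₂ π i ∘₁ u} {χ : ∀ i → π i ∘₁ u ⇒₂ π i ∘₁ v} →
                            (∀ i → id₂ ∘ₕ φ ≈₂ θ i) → (∀ i → id₂ ∘ₕ ψ ≈₂ χ i) →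
                            (∀ i → θ i ∘ᵥ χ i ≈₂ id₂) → φ ∘ᵥ ψ ≈₂ id₂
    inverse-by-components {φ = φ} {ψ} {θ} {χ} φ-commute ψ-commute θχ = hom-inj _ _ λ i → ≅⇒≈ (begin
      id₂ ∘ₕ (φ ∘ᵥ ψ)           ≅⟨ whiskerˡ-∘ᵥ ⟩
      (id₂ ∘ₕ φ) ∘ᵥ (id₂ ∘ₕ ψ)  ≅⟨ ∘ᵥ-≅ (≈⇒≅ (φ-commute i)) (≈⇒≅ (ψ-commute i)) ⟩
      θ i ∘ᵥ χ i                ≈⟨ θχ i ⟩
      id₂                       ≅⟨ ≅-sym ∘ₕ-id≅ ⟩
      id₂ ∘ₕ id₂                ∎)

    hom-surj-iso : ∀ {Q} {u v : Q ⇒₁ P} (θ : (i : Fin n) → π i ∘₁ u ⇒₂ π i ∘₁ v) →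
                   ((i : Fin n) → IsIso₂ (θ i)) → IsIso₂ (proj₁ (hom-surj θ))
    hom-surj-iso θ isos =
      proj₁ (hom-surj θ⁻) ,
      inverse-by-components (proj₂ (hom-surj θ⁻)) (proj₂ (hom-surj θ)) (λ i → proj₁ (proj₂ (isos i))) ,
      inverse-by-components (proj₂ (hom-surj θ)) (proj₂ (hom-surj θ⁻)) (λ i → proj₂ (proj₂ (isos i)))
      where
      θ⁻ = λ i → proj₁ (isos i)

    components⇒iso-to-id : ∀ {P′} {Y : Fin n → Obj} {π′ : (i : Fin n) → P′ ⇒₁ Y i}
                           {f : P ⇒₁ P′} {g : P′ ⇒₁ P} {fᵢ : ∀ i → X i ⇒₁ Y i} {gᵢ : ∀ i → Y i ⇒₁ X i} →
                           (∀ i → π′ i ∘₁ f ≡ fᵢ i ∘₁ π i) → (∀ i → π i ∘₁ g ≡ gᵢ i ∘₁ π′ i) →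
                           (η : ∀ i → gᵢ i ∘₁ fᵢ i ⇒₂ id₁) → (∀ i → IsIso₂ (η i)) →
                           Σ (g ∘₁ f ⇒₂ id₁) IsIso₂
    components⇒iso-to-id {π′ = π′} {f} {g} {fᵢ} {gᵢ} f-commute g-commute η η-iso =
      proj₁ (hom-surj θ) , hom-surj-iso θ (λ i → iso-cast _ _ (iso-∘ₕ (η-iso i) iso-id))
      where
      π∘g∘f : ∀ i → (gᵢ i ∘₁ fᵢ i) ∘₁ π i ≡ π i ∘₁ (g ∘₁ f)
      π∘g∘f i = sym (trans (sym assoc₁) (trans (cong (_∘₁ f) (g-commute i))
                  (trans assoc₁ (trans (cong (gᵢ i ∘₁_) (f-commute i)) (sym assoc₁)))))

      θ : ∀ i → π i ∘₁ (g ∘₁ f) ⇒₂ π i ∘₁ id₁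
      θ i = cast (π∘g∘f i) (trans identityˡ₁ (sym identityʳ₁)) (η i ∘ₕ id₂ {f = π i})

module Transport {o ℓ t e} (D : TwoCategory o ℓ t e) where
  open TwoCategory D
  private module U = Category underlying
  open U public using (_≈[_,_]_)

  ⌜_⌝ : ∀ {A B} → A ≡ B → A ⇒₁ B
  ⌜ p ⌝ = U.idTo p

  tr₁ : ∀ {A A′ B B′} → A ≡ A′ → B ≡ B′ → A ⇒₁ B → A′ ⇒₁ B′
  tr₁ refl refl f = f

  ⌜⌝-inverse : ∀ {A B} (p : A ≡ B) → ⌜ p ⌝ ∘₁ ⌜ sym p ⌝ ≡ id₁
  ⌜⌝-inverse refl = identityˡ₁

  tr₁-equivalence : ∀ {A A′ B B′} (p : A ≡ A′) (q : B ≡ B′) {f : A ⇒₁ B} →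
                    IsEquivalence₁ f → IsEquivalence₁ (tr₁ p q f)
  tr₁-equivalence refl refl x = x

  ≈[]-sym : ∀ {A A′ B B′} (p : A ≡ A′) (q : B ≡ B′) {f : A ⇒₁ B} {g : A′ ⇒₁ B′} →
            f ≈[ p , q ] g → g ≈[ sym p , sym q ] f
  ≈[]-sym refl refl h =
    trans identityˡ₁ (trans (sym identityʳ₁) (trans (sym h) (trans identityˡ₁ (sym identityʳ₁))))

  ≈[]-trans : ∀ {A A′ A″ B B′ B″} (p : A ≡ A′) (p′ : A′ ≡ A″) (q : B ≡ B′) (q′ : B′ ≡ B″)
              {f : A ⇒₁ B} {g : A′ ⇒₁ B′} {h : A″ ⇒₁ B″} →
              f ≈[ p , q ] g → g ≈[ p′ , q′ ] h → f ≈[ trans p p′ , trans q q′ ] h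
  ≈[]-trans refl refl refl refl fg gh = trans fg (trans identityʳ₁ (trans (sym identityˡ₁) gh))

  tr₁-∘₁-conjugate : ∀ {A A′ B B′ E E′} (p : A ≡ A′) (q : B ≡ B′) (r : E ≡ E′)
                     {f : B ⇒₁ E} {g : A ⇒₁ B} {h : A′ ⇒₁ B′} →
                     g ≈[ p , q ] h → tr₁ q r f ∘₁ h ≡ ⌜ r ⌝ ∘₁ ((f ∘₁ g) ∘₁ ⌜ sym p ⌝)
  tr₁-∘₁-conjugate refl refl refl {f} gh =
    trans (cong (f ∘₁_) (trans (sym identityʳ₁) (trans (sym gh) identityˡ₁)))
          (sym (trans identityˡ₁ identityʳ₁))

  conjugate-∘₁-tr₁ : ∀ {A A′ C C′ E E′} (p : A ≡ A′) (q : C ≡ C′) (r : E ≡ E′)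
                     {f : A ⇒₁ C} {g : C ⇒₁ E} {h : C′ ⇒₁ E′} →
                     g ≈[ q , r ] h → ⌜ r ⌝ ∘₁ ((g ∘₁ f) ∘₁ ⌜ sym p ⌝) ≡ h ∘₁ tr₁ p q f
  conjugate-∘₁-tr₁ refl refl refl {f} gh =
    trans (trans identityˡ₁ identityʳ₁) (cong (_∘₁ f) (trans (sym identityˡ₁) (trans gh identityʳ₁)))

  tr₂ : ∀ {A A′ B B′} (p : A ≡ A′) (q : B ≡ B′) {f g : A ⇒₁ B} → f ⇒₂ g → tr₁ p q f ⇒₂ tr₁ p q g
  tr₂ refl refl φ = φ

  iso-tr₂ : ∀ {A A′ B B′} (p : A ≡ A′) (q : B ≡ B′) {f g : A ⇒₁ B} {φ : f ⇒₂ g} →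
            IsIso₂ φ → IsIso₂ (tr₂ p q φ)
  iso-tr₂ refl refl i = i

  ≈[]-∘₁-tr₁ : ∀ {A A′ B B′ E E′} (p : A ≡ A′) (q : B ≡ B′) (r : E ≡ E′)
               {a : B ⇒₁ E} {a′ : B′ ⇒₁ E′} (x : A ⇒₁ B) →
               a ≈[ q , r ] a′ → a′ ∘₁ tr₁ p q x ≡ tr₁ p r (a ∘₁ x)
  ≈[]-∘₁-tr₁ refl refl refl x aa′ = cong (_∘₁ x) (sym (trans (sym identityˡ₁) (trans aa′ identityʳ₁)))

  tr₁-∘₁-≈[] : ∀ {A A′ B B′ E E′} (p : A ≡ A′) (q : B ≡ B′) (r : E ≡ E′)
               {b : A ⇒₁ B} {b′ : A′ ⇒₁ B′} (y : B ⇒₁ E) →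
               b ≈[ p , q ] b′ → tr₁ q r y ∘₁ b′ ≡ tr₁ p r (y ∘₁ b)
  tr₁-∘₁-≈[] refl refl refl y bb′ = cong (y ∘₁_) (sym (trans (sym identityˡ₁) (trans bb′ identityʳ₁)))

  module _ {s f} (σ : Signature s f) where
    open Signature σ

    ≐-sym : {X Y : Interpretation σ underlying} → _≐_ σ underlying X Y → _≐_ σ underlying Y X
    ≐-sym h = record
      { sort≡ = λ A → sym (sort≡ A)
      ; prod≡ = λ As → sym (prod≡ As)
      ; π≈    = λ As j → ≈[]-sym (prod≡ As) (sort≡ (lookup As j)) (π≈ As j)
      ; fun≈  = λ {As} {B} g → ≈[]-sym (prod≡ As) (sort≡ B) (fun≈ g)
      }
      where open _≐_ h

    ≐-trans : {X Y Z : Interpretation σ underlying} →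
              _≐_ σ underlying X Y → _≐_ σ underlying Y Z → _≐_ σ underlying X Z
    ≐-trans h h′ = record
      { sort≡ = λ A → trans (H.sort≡ A) (H′.sort≡ A)
      ; prod≡ = λ As → trans (H.prod≡ As) (H′.prod≡ As)
      ; π≈    = λ As j → ≈[]-trans (H.prod≡ As) (H′.prod≡ As) (H.sort≡ (lookup As j))
                                   (H′.sort≡ (lookup As j)) (H.π≈ As j) (H′.π≈ As j)
      ; fun≈  = λ {As} {B} g → ≈[]-trans (H.prod≡ As) (H′.prod≡ As) (H.sort≡ B) (H′.sort≡ B)
                                         (H.fun≈ g) (H′.fun≈ g)
      }
      where
      module H = _≐_ h
      module H′ = _≐_ h′

    homotopyEquivalent-≐ : {M M′ N N′ : Interpretation σ underlying} →
                           _≐_ σ underlying M M′ → _≐_ σ underlying N N′ →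
                           HomotopyEquivalent σ D M N → HomotopyEquivalent σ D M′ N′
    homotopyEquivalent-≐ {M} {M′} {N} {N′} hM hN (α , α-equiv) =
      record { α₁ = α₁′ ; α₂ = α₂′ ; α₂-iso = λ g → iso-cast _ _ (iso-tr₂ (hM.prod≡ _) (hN.sort≡ _) (α₂-iso g)) } ,
      λ A → tr₁-equivalence _ _ (α-equiv A)
      where
      open HomotopyHom α
      open TwoCells D using (cast; iso-cast)
      open ≡-Reasoning
      module M = Interpretation M
      module M′ = Interpretation M′
      module N = Interpretation N
      module N′ = Interpretation N′
      module hM = _≐_ hM
      module hN = _≐_ hN

      α₁′ : (A : Sort) → M′.⟦ A ⟧ ⇒₁ N′.⟦ A ⟧
      α₁′ A = tr₁ (hM.sort≡ A) (hN.sort≡ A) (α₁ A)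

      ×map-≐ : ∀ As → ×map σ underlying M′ N′ α₁′ As
                      ≡ tr₁ (hM.prod≡ As) (hN.prod≡ As) (×map σ underlying M N α₁ As)
      ×map-≐ As = sym (U.IsProduct.unique (N′.isProduct As) _ _ λ j → begin
        N′.π As j ∘₁ tr₁ (hM.prod≡ As) (hN.prod≡ As) (×map σ underlying M N α₁ As)
          ≡⟨ ≈[]-∘₁-tr₁ _ _ _ _ (hN.π≈ As j) ⟩
        tr₁ (hM.prod≡ As) (hN.sort≡ (lookup As j)) (N.π As j ∘₁ ×map σ underlying M N α₁ As)
          ≡⟨ cong (tr₁ _ _) (U.IsProduct.commute (N.isProduct As) _ j) ⟩
        tr₁ (hM.prod≡ As) (hN.sort≡ (lookup As j)) (α₁ (lookup As j) ∘₁ M.π As j)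
          ≡⟨ sym (tr₁-∘₁-≈[] _ _ _ _ (hM.π≈ As j)) ⟩
        α₁′ (lookup As j) ∘₁ M′.π As j ∎)

      α₂′ : ∀ {As B} (g : Fun As B) →
            α₁′ B ∘₁ M′.⟦ g ⟧f ⇒₂ N′.⟦ g ⟧f ∘₁ ×map σ underlying M′ N′ α₁′ As
      α₂′ {As} {B} g =
        cast (sym (tr₁-∘₁-≈[] (hM.prod≡ As) (hM.sort≡ B) (hN.sort≡ B) (α₁ B) (hM.fun≈ g)))
             (trans (sym (≈[]-∘₁-tr₁ (hM.prod≡ As) (hN.prod≡ As) (hN.sort≡ B)
                                     (×map σ underlying M N α₁ As) (hN.fun≈ g)))
                    (cong (N′.⟦ g ⟧f ∘₁_) (sym (×map-≐ As))))
             (tr₂ (hM.prod≡ As) (hN.sort≡ B) (α₂ g))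

module Restriction {o′ ℓ′ t′ e′} (D : TwoCategory o′ ℓ′ t′ e′) (has2 : TwoCategory.HasFinite2Products D)
                   {s f} (σ : Signature s f) where
  open Signature σ
  open TwoCategory D
  open TwoCells D
  open TwoProducts D has2

  module _ {o ℓ e} {C : Category o ℓ e} (i : Interpretation σ C) (F G : FPFunctor C underlying)
           (β-pseudonatural : PseudonaturallyEquivalent D F G) where
    private
      β = proj₁ β-pseudonatural
      open PseudoNat β
      module i = Interpretation i
      module F = FPFunctor F
      module G = FPFunctor G
      module G∘i = Interpretation (_∘I_ σ G i)

      α₁ : (A : Sort) → F.F₀ i.⟦ A ⟧ ⇒₁ G.F₀ i.⟦ A ⟧
      α₁ A = β₁ i.⟦ A ⟧

      ×α : (As : List Sort) → F.F₀ i.⟦ As ⟧* ⇒₁ G.F₀ i.⟦ As ⟧*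
      ×α = ×map σ underlying (_∘I_ σ F i) (_∘I_ σ G i) α₁

      -- The pseudonaturality cells at the projections exhibit β at a product as
      -- the product of the β's, up to an invertible 2-cell.
      β-projection : (As : List Sort) (j : Fin (length As)) →
                     G.F₁ (i.π As j) ∘₁ β₁ i.⟦ As ⟧* ⇒₂ G.F₁ (i.π As j) ∘₁ ×α As
      β-projection As j =
        cast refl (sym (U.IsProduct.commute (G∘i.isProduct As) _ j)) (proj₁ (β₂-iso (i.π As j)))
        where module U = Category underlying

      β⇒×α : (As : List Sort) → β₁ i.⟦ As ⟧* ⇒₂ ×α As
      β⇒×α As = proj₁ (Is2Product.hom-surj (product⇒2-product (G∘i.isProduct As)) (β-projection As))

      iso-β⇒×α : (As : List Sort) → IsIso₂ (β⇒×α As)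
      iso-β⇒×α As = hom-surj-iso (product⇒2-product (G∘i.isProduct As)) (β-projection As)
                      (λ j → iso-cast _ _ (iso-inv (β₂-iso (i.π As j))))

      α₂ : ∀ {As B} (g : Fun As B) →
           α₁ B ∘₁ F.F₁ i.⟦ g ⟧f ⇒₂ G.F₁ i.⟦ g ⟧f ∘₁ ×α As
      α₂ {As} g = (id₂ ∘ₕ β⇒×α As) ∘ᵥ β₂ i.⟦ g ⟧f

    restrict-pseudonatural : HomotopyEquivalent σ D (_∘I_ σ F i) (_∘I_ σ G i)
    restrict-pseudonatural =
      record { α₁ = α₁ ; α₂ = α₂ ; α₂-iso = λ g → iso-∘ᵥ (iso-∘ₕ iso-id (iso-β⇒×α _)) (β₂-iso _) } ,
      λ A → proj₂ β-pseudonatural i.⟦ A ⟧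

module Underlying {o′ ℓ′ t′ e′} (D : TwoCategory o′ ℓ′ t′ e′) where
  open TwoCategory D
  open Transport D
  private module U = Category underlying

  underlyingFP : HasFinite2Products → FPCat o′ ℓ′ ℓ′
  underlyingFP has2 = record
    { cat      = underlying
    ; products = λ n X → let module T = TwoProduct (has2 n X) in
        record { P = T.P ; π = T.π ; isProduct = Is2Product.isProduct T.is2Product }
    }

  module _ {o ℓ e} (E : Category o ℓ e) (products : Category.HasFiniteProducts E)
           (G : Functor E underlying) where
    private
      module E = Category E
      module G = Functor G
      module ≈E {A B} = IsEquivalence (E.≈-equiv {A} {B})

    preserves-via-chosen : (∀ n (X : Fin n → E.Obj) →
                             U.IsProduct (λ i → G.F₀ (X i)) (G.F₀ (E.Product.P (products n X)))
                                         (λ i → G.F₁ (E.Product.π (products n X) i))) →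
                           PreservesFiniteProducts E underlying G
    preserves-via-chosen G-chosen {n} {X} {P} {π} isP = record
      { ⟨_⟩     = λ f → G.F₁ fromChosen ∘₁ GChosen.⟨ f ⟩
      ; commute = λ f i → trans (sym assoc₁)
                            (trans (cong (_∘₁ GChosen.⟨ f ⟩) (trans (sym G.homomorphism) (G.F-resp-≈ (fromChosen-commute i))))
                                   (GChosen.commute f i))
      ; unique  = λ f h h-commute →
          trans (sym identityˡ₁)
          (trans (cong (_∘₁ h) (trans (sym G.identity) (trans (G.F-resp-≈ (≈E.sym fromChosen∘toChosen)) G.homomorphism)))
          (trans assoc₁ (cong (G.F₁ fromChosen ∘₁_) (GChosen.unique f (G.F₁ toChosen ∘₁ h)
            (λ i → trans (sym assoc₁) (trans (cong (_∘₁ h) (trans (sym G.homomorphism) (G.F-resp-≈ (toChosen-commute i))))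
                                             (h-commute i)))))))
      }
      where
      module Chosen = E.Product (products n X)
      module Chosen′ = E.IsProduct Chosen.isProduct
      module P = E.IsProduct isP
      module GChosen = U.IsProduct (G-chosen n X)

      toChosen = Chosen′.⟨ π ⟩

      toChosen-commute : ∀ i → Chosen.π i E.∘ toChosen E.≈ π i
      toChosen-commute = Chosen′.commute π

      fromChosen = P.⟨ Chosen.π ⟩

      fromChosen-commute : ∀ i → π i E.∘ fromChosen E.≈ Chosen.π i
      fromChosen-commute = P.commute Chosen.π

      fromChosen∘toChosen : fromChosen E.∘ toChosen E.≈ E.id
      fromChosen∘toChosen =
        ≈E.trans (P.unique π (fromChosen E.∘ toChosen)
                   (λ i → ≈E.trans (≈E.sym E.assoc) (≈E.trans (E.∘-resp-≈ (fromChosen-commute i) ≈E.refl)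
                                                               (toChosen-commute i))))
                 (≈E.sym (P.unique π E.id (λ i → E.identityʳ)))

  module _ {o ℓ e o₂ ℓ₂ e₂} {C : Category o ℓ e} {E : Category o₂ ℓ₂ e₂} where
    infixr 9 _∘FP_
    _∘FP_ : FPFunctor E underlying → FPFunctor C E → FPFunctor C underlying
    G ∘FP F = record
      { functor = record
        { F₀           = λ X → G.F₀ (F.F₀ X)
        ; F₁           = λ f → G.F₁ (F.F₁ f)
        ; identity     = trans (G.F-resp-≈ F.identity) G.identity
        ; homomorphism = trans (G.F-resp-≈ F.homomorphism) G.homomorphism
        ; F-resp-≈     = λ p → G.F-resp-≈ (F.F-resp-≈ p)
        }
      ; preserves = λ isP → G.preserves (F.preserves isP)
      }
      where
      module G = FPFunctor G
      module F = FPFunctor F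

  module _ {s f} (σ : Signature s f) where
    open Signature σ

    ≐-∘I : ∀ {o ℓ e} {E : Category o ℓ e} (G : FPFunctor E underlying) {X Y : Interpretation σ E} →
           _≐_ σ E X Y → _≐_ σ underlying (_∘I_ σ G X) (_∘I_ σ G Y)
    ≐-∘I {E = E} G h = record
      { sort≡ = λ A → cong G.F₀ (sort≡ A)
      ; prod≡ = λ As → cong G.F₀ (prod≡ As)
      ; π≈    = λ As j → G-≈[] (prod≡ As) (sort≡ (lookup As j)) (π≈ As j)
      ; fun≈  = λ {As} {B} g → G-≈[] (prod≡ As) (sort≡ B) (fun≈ g)
      }
      where
      module E = Category E
      module G = FPFunctor G
      open _≐_ h

      G-idTo : ∀ {A B} (p : A ≡ B) → G.F₁ (E.idTo p) ≡ ⌜ cong G.F₀ p ⌝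
      G-idTo refl = G.identity

      G-≈[] : ∀ {A B A′ B′} {a : A E.⇒ B} {b : A′ E.⇒ B′} (p : A ≡ A′) (q : B ≡ B′) →
              a E.≈[ p , q ] b → G.F₁ a ≈[ cong G.F₀ p , cong G.F₀ q ] G.F₁ b
      G-≈[] p q ab = trans (cong (_∘₁ _) (sym (G-idTo q)))
                     (trans (sym G.homomorphism) (trans (G.F-resp-≈ ab) (trans G.homomorphism (cong (_ ∘₁_) (G-idTo p)))))

    ∘FP-∘I : ∀ {o ℓ e o₂ ℓ₂ e₂} {C : Category o ℓ e} {E : Category o₂ ℓ₂ e₂}
             (G : FPFunctor E underlying) (F : FPFunctor C E) (i : Interpretation σ C) →
             _≐_ σ underlying (_∘I_ σ (G ∘FP F) i) (_∘I_ σ G (_∘I_ σ F i))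
    ∘FP-∘I G F i = record
      { sort≡ = λ A → refl
      ; prod≡ = λ As → refl
      ; π≈    = λ As j → trans identityˡ₁ (sym identityʳ₁)
      ; fun≈  = λ g → trans identityˡ₁ (sym identityʳ₁)
      }

singleton-isProduct : ∀ {o ℓ e} (E : Category o ℓ e) (X : Fin 1 → Category.Obj E)
                      (π : (i : Fin 1) → Category._⇒_ E (X zero) (X i)) →
                      Category._≈_ E (π zero) (Category.id E) → Category.IsProduct E X (X zero) π
singleton-isProduct E X π π≈id = record
  { ⟨_⟩     = λ f → f zero
  ; commute = λ { f zero → ≈E.trans (∘-resp-≈ π≈id ≈E.refl) identityˡ }
  ; unique  = λ f h h-commute → ≈E.trans (≈E.sym identityˡ) (≈E.trans (∘-resp-≈ (≈E.sym π≈id) ≈E.refl) (h-commute zero))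
  }
  where
  open Category E
  module ≈E {A B} = IsEquivalence (≈-equiv {A} {B})

module Squares {o ℓ t e} (D : TwoCategory o ℓ t e) where
  open TwoCategory D
  open TwoCells D

  record EquivArrow : Set (o ⊔ ℓ ⊔ t ⊔ e) where
    constructor equivArrow
    field
      dom cod   : Obj
      arr       : dom ⇒₁ cod
      arr-equiv : IsEquivalence₁ arr
  open EquivArrow public

  record Square (X Y : EquivArrow) : Set (ℓ ⊔ t ⊔ e) where
    constructor square
    field
      top      : dom X ⇒₁ dom Y
      bottom   : cod X ⇒₁ cod Y
      cell     : arr Y ∘₁ top ⇒₂ bottom ∘₁ arr X
      cell-iso : IsIso₂ cell
  open Square public

  infix 4 _≈□_
  record _≈□_ {X Y} (h k : Square X Y) : Set (ℓ ⊔ e) where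
    constructor mk≈□
    field
      ≈-top    : top h ≡ top k
      ≈-bottom : bottom h ≡ bottom k
      ≈-cell   : cell h ≅ cell k
  open _≈□_ public

  paste : ∀ {X Y Z X′ Y′ Z′ : Obj} {eX : X ⇒₁ X′} {eY : Y ⇒₁ Y′} {eZ : Z ⇒₁ Z′}
          {f₁ : X ⇒₁ Y} {g₁ : X′ ⇒₁ Y′} {f₂ : Y ⇒₁ Z} {g₂ : Y′ ⇒₁ Z′} →
          eZ ∘₁ f₂ ⇒₂ g₂ ∘₁ eY → eY ∘₁ f₁ ⇒₂ g₁ ∘₁ eX → eZ ∘₁ (f₂ ∘₁ f₁) ⇒₂ (g₂ ∘₁ g₁) ∘₁ eX
  paste {f₁ = f₁} {g₂ = g₂} ψ φ =
    idTo₂ (sym assoc₁) ∘ᵥ (id₂ {f = g₂} ∘ₕ φ) ∘ᵥ idTo₂ assoc₁ ∘ᵥ (ψ ∘ₕ id₂ {f = f₁}) ∘ᵥ idTo₂ (sym assoc₁)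

  paste-iso : ∀ {X Y Z X′ Y′ Z′ : Obj} {eX : X ⇒₁ X′} {eY : Y ⇒₁ Y′} {eZ : Z ⇒₁ Z′}
              {f₁ : X ⇒₁ Y} {g₁ : X′ ⇒₁ Y′} {f₂ : Y ⇒₁ Z} {g₂ : Y′ ⇒₁ Z′}
              {ψ : eZ ∘₁ f₂ ⇒₂ g₂ ∘₁ eY} {φ : eY ∘₁ f₁ ⇒₂ g₁ ∘₁ eX} →
              IsIso₂ ψ → IsIso₂ φ → IsIso₂ (paste ψ φ)
  paste-iso ψ-iso φ-iso =
    iso-∘ᵥ (iso-idTo _) (iso-∘ᵥ (iso-∘ₕ iso-id φ-iso)
      (iso-∘ᵥ (iso-idTo _) (iso-∘ᵥ (iso-∘ₕ ψ-iso iso-id) (iso-idTo _))))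

  paste-isIdˡ : ∀ {X Y Z X′ Y′ Z′ : Obj} {eX : X ⇒₁ X′} {eY : Y ⇒₁ Y′} {eZ : Z ⇒₁ Z′}
                {f₁ : X ⇒₁ Y} {g₁ : X′ ⇒₁ Y′} {f₂ : Y ⇒₁ Z} {g₂ : Y′ ⇒₁ Z′}
                {ψ : eZ ∘₁ f₂ ⇒₂ g₂ ∘₁ eY} {φ : eY ∘₁ f₁ ⇒₂ g₁ ∘₁ eX} →
                IsId₂ ψ → paste ψ φ ≅ id₂ {f = g₂} ∘ₕ φ
  paste-isIdˡ ψ-id =
    ≅-trans (idTo₂-absorbˡ _)
            (isId-absorbʳ (isId-∘ᵥ (isId-idTo _) (isId-∘ᵥ (isId-∘ₕ ψ-id isId-id) (isId-idTo _))))

  paste-isIdʳ : ∀ {X Y Z X′ Y′ Z′ : Obj} {eX : X ⇒₁ X′} {eY : Y ⇒₁ Y′} {eZ : Z ⇒₁ Z′}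
                {f₁ : X ⇒₁ Y} {g₁ : X′ ⇒₁ Y′} {f₂ : Y ⇒₁ Z} {g₂ : Y′ ⇒₁ Z′}
                {ψ : eZ ∘₁ f₂ ⇒₂ g₂ ∘₁ eY} {φ : eY ∘₁ f₁ ⇒₂ g₁ ∘₁ eX} →
                IsId₂ φ → paste ψ φ ≅ ψ ∘ₕ id₂ {f = f₁}
  paste-isIdʳ φ-id =
    ≅-trans (idTo₂-absorbˡ _) (≅-trans (isId-absorbˡ (isId-∘ₕ isId-id φ-id))
                                       (≅-trans (idTo₂-absorbˡ _) (idTo₂-absorbʳ _)))

  id□ : ∀ {X} → Square X X
  id□ = square id₁ id₁ (idTo₂ (trans identityʳ₁ (sym identityˡ₁))) (iso-idTo _)

  infixr 9 _∘□_
  _∘□_ : ∀ {X Y Z} → Square Y Z → Square X Y → Square X Z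
  k ∘□ h = square (top k ∘₁ top h) (bottom k ∘₁ bottom h) (paste (cell k) (cell h))
                  (paste-iso (cell-iso k) (cell-iso h))

  ≈□-refl : ∀ {X Y} {h : Square X Y} → h ≈□ h
  ≈□-refl = mk≈□ refl refl ≅-refl

  ≈□-sym : ∀ {X Y} {h k : Square X Y} → h ≈□ k → k ≈□ h
  ≈□-sym (mk≈□ p q r) = mk≈□ (sym p) (sym q) (≅-sym r)

  ≈□-trans : ∀ {X Y} {h k l : Square X Y} → h ≈□ k → k ≈□ l → h ≈□ l
  ≈□-trans (mk≈□ p q r) (mk≈□ p′ q′ r′) = mk≈□ (trans p p′) (trans q q′) (≅-trans r r′)

  ∘□-resp-≈□ : ∀ {X Y Z} {k k′ : Square Y Z} {h h′ : Square X Y} → k ≈□ k′ → h ≈□ h′ → k ∘□ h ≈□ k′ ∘□ h′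
  ∘□-resp-≈□ {k = square _ _ _ _} {square _ _ _ _} {square _ _ _ _} {square _ _ _ _}
             (mk≈□ refl refl k≅k′) (mk≈□ refl refl h≅h′) =
    mk≈□ refl refl (∘ᵥ-≅ ≅-refl (∘ᵥ-≅ (∘ₕ-≅ ≅-refl h≅h′) (∘ᵥ-≅ ≅-refl (∘ᵥ-≅ (∘ₕ-≅ k≅k′ ≅-refl) ≅-refl))))

  id□-identityˡ : ∀ {X Y} {h : Square X Y} → id□ ∘□ h ≈□ h
  id□-identityˡ = mk≈□ identityˡ₁ identityˡ₁ (≅-trans (paste-isIdˡ (isId-idTo _)) identityˡₕ≅)

  id□-identityʳ : ∀ {X Y} {h : Square X Y} → h ∘□ id□ ≈□ h
  id□-identityʳ = mk≈□ identityʳ₁ identityʳ₁ (≅-trans (paste-isIdʳ (isId-idTo _)) identityʳₕ≅)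

  -- After distributing the whiskerings, both pastings are the same three cells
  -- separated by identity-like cells, and those agree as soon as their ends do.
  ∘□-assoc : ∀ {X Y Z W} {h₁ : Square X Y} {h₂ : Square Y Z} {h₃ : Square Z W} →
             (h₃ ∘□ h₂) ∘□ h₁ ≈□ h₃ ∘□ (h₂ ∘□ h₁)
  ∘□-assoc {Y = Y} {h₁ = h₁} {h₂} {h₃} =
    mk≈□ assoc₁ assoc₁ (≅-trans lhs-spread (≅-trans pieces (≅-sym rhs-spread)))
    where
    lhs-spread = ≅-trans (∘ᵥ-≅ ≅-refl (∘ᵥ-≅ ≅-refl (∘ᵥ-≅ ≅-refl (∘ᵥ-≅ whiskerʳ-∘ᵥ⁵ ≅-refl))))
                         (∘ᵥ-≅ ≅-refl (∘ᵥ-≅ ≅-refl (≅-trans (∘ᵥ-≅ ≅-refl assocᵥ⁵) (≅-sym assocᵥ≅))))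
    rhs-spread = ≅-trans (∘ᵥ-≅ ≅-refl (∘ᵥ-≅ whiskerˡ-∘ᵥ⁵ ≅-refl))
                   (≅-trans (∘ᵥ-≅ ≅-refl assocᵥ⁵)
                   (≅-trans (≅-sym assocᵥ≅)
                     (∘ᵥ-≅ ≅-refl (∘ᵥ-≅ ≅-refl (∘ᵥ-≅ ≅-refl (∘ᵥ-≅ ≅-refl (≅-sym assocᵥ≅)))))))
    h₁-cell = ≅-sym whiskerˡ-whiskerˡ
    h₂-cell : (id₂ {f = bottom h₃} ∘ₕ cell h₂) ∘ₕ id₂ {f = top h₁}
              ≅ id₂ {f = bottom h₃} ∘ₕ (cell h₂ ∘ₕ id₂ {f = top h₁})
    h₂-cell = assocₕ≅
    h₃-cell = ≅-trans assocₕ≅ (∘ₕ-≅ ≅-refl ∘ₕ-id≅)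
    pieces =
      ∘ᵥ-≅ (isId-≅-by-src (isId-idTo _) (isId-∘ᵥ (isId-idTo _) (isId-whiskerˡ-idTo _)) (≅-tgt h₁-cell))
      (∘ᵥ-≅ h₁-cell
      (∘ᵥ-≅ (isId-≅-by-src (isId-∘ᵥ (isId-idTo _) (isId-idTo-whiskerʳ _))
              (isId-whiskerˡ-idTo {h = bottom h₃} (assoc₁ {f = top h₁} {g = arr Y} {h = bottom h₂}))
              (≅-tgt h₂-cell))
      (∘ᵥ-≅ h₂-cell
      (∘ᵥ-≅ (isId-≅-by-src (isId-idTo-whiskerʳ _) (isId-∘ᵥ (isId-whiskerˡ-idTo _) (isId-idTo _)) (≅-tgt h₃-cell))
      (∘ᵥ-≅ h₃-cell
      (isId-≅-by-tgt (isId-∘ᵥ (isId-idTo-whiskerʳ _) (isId-idTo _)) (isId-idTo _) (≅-src h₃-cell)))))))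

  SquareCat : Category (o ⊔ ℓ ⊔ t ⊔ e) (ℓ ⊔ t ⊔ e) (ℓ ⊔ e)
  SquareCat = record
    { Obj       = EquivArrow
    ; _⇒_       = Square
    ; _≈_       = _≈□_
    ; id        = id□
    ; _∘_       = _∘□_
    ; ≈-equiv   = record { refl = ≈□-refl ; sym = ≈□-sym ; trans = ≈□-trans }
    ; ∘-resp-≈  = ∘□-resp-≈□
    ; assoc     = λ {_ _ _ _ h₁ h₂ h₃} → ∘□-assoc {h₁ = h₁} {h₂} {h₃}
    ; identityˡ = id□-identityˡ
    ; identityʳ = id□-identityʳ
    }

module SquareProducts {o ℓ t e} (D : TwoCategory o ℓ t e) (has2 : TwoCategory.HasFinite2Products D) where
  open TwoCategory D
  open TwoCells D
  open Squares D
  open TwoProducts D has2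

  module _ {n} (X : Fin n → EquivArrow)
           {PA : Obj} {πA : (i : Fin n) → PA ⇒₁ dom (X i)} (isA : Is2Product (λ i → dom (X i)) PA πA)
           {PB : Obj} {πB : (i : Fin n) → PB ⇒₁ cod (X i)} (isB : Is2Product (λ i → cod (X i)) PB πB) where
    private
      module A = Is2Product isA
      module B = Is2Product isB
      module A₁ = Category.IsProduct A.isProduct
      module B₁ = Category.IsProduct B.isProduct

      inv : ∀ i → cod (X i) ⇒₁ dom (X i)
      inv i = proj₁ (arr-equiv (X i))

      ×arr : PA ⇒₁ PB
      ×arr = B₁.⟨ (λ i → arr (X i) ∘₁ πA i) ⟩

      ×arr-commute : ∀ i → πB i ∘₁ ×arr ≡ arr (X i) ∘₁ πA i
      ×arr-commute = B₁.commute (λ i → arr (X i) ∘₁ πA i)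

      ×inv : PB ⇒₁ PA
      ×inv = A₁.⟨ (λ i → inv i ∘₁ πB i) ⟩

      ×inv-commute : ∀ i → πA i ∘₁ ×inv ≡ inv i ∘₁ πB i
      ×inv-commute = A₁.commute (λ i → inv i ∘₁ πB i)

      ×arr-equiv : IsEquivalence₁ ×arr
      ×arr-equiv =
        ×inv ,
        components⇒iso-to-id isA ×arr-commute ×inv-commute
          (λ i → proj₁ (proj₁ (proj₂ (arr-equiv (X i))))) (λ i → proj₂ (proj₁ (proj₂ (arr-equiv (X i))))) ,
        components⇒iso-to-id isB ×inv-commute ×arr-commute
          (λ i → proj₁ (proj₂ (proj₂ (arr-equiv (X i))))) (λ i → proj₂ (proj₂ (proj₂ (arr-equiv (X i)))))

    ×obj : EquivArrow
    ×obj = equivArrow PA PB ×arr ×arr-equiv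

    ×π : (i : Fin n) → Square ×obj (X i)
    ×π i = square (πA i) (πB i) (idTo₂ (sym (×arr-commute i))) (iso-idTo _)

    module _ {Q : EquivArrow} (h : (i : Fin n) → Square Q (X i)) where
      private
        ⟨tops⟩ : dom Q ⇒₁ PA
        ⟨tops⟩ = A₁.⟨ (λ i → top (h i)) ⟩

        ⟨bottoms⟩ : cod Q ⇒₁ PB
        ⟨bottoms⟩ = B₁.⟨ (λ i → bottom (h i)) ⟩

        cells : ∀ i → πB i ∘₁ (×arr ∘₁ ⟨tops⟩) ⇒₂ πB i ∘₁ (⟨bottoms⟩ ∘₁ arr Q)
        cells i = cast (sym πB∘×arr∘⟨tops⟩) (sym πB∘⟨bottoms⟩∘arr) (cell (h i))
          where
          πB∘×arr∘⟨tops⟩ : πB i ∘₁ (×arr ∘₁ ⟨tops⟩) ≡ arr (X i) ∘₁ top (h i)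
          πB∘×arr∘⟨tops⟩ = trans (sym assoc₁) (trans (cong (_∘₁ ⟨tops⟩) (×arr-commute i))
                             (trans assoc₁ (cong (arr (X i) ∘₁_) (A₁.commute (λ j → top (h j)) i))))

          πB∘⟨bottoms⟩∘arr : πB i ∘₁ (⟨bottoms⟩ ∘₁ arr Q) ≡ bottom (h i) ∘₁ arr Q
          πB∘⟨bottoms⟩∘arr = trans (sym assoc₁) (cong (_∘₁ arr Q) (B₁.commute (λ j → bottom (h j)) i))

        pair-cell : ×arr ∘₁ ⟨tops⟩ ⇒₂ ⟨bottoms⟩ ∘₁ arr Q
        pair-cell = proj₁ (B.hom-surj cells)

        pair-cell-commute : ∀ i → id₂ {f = πB i} ∘ₕ pair-cell ≈₂ cells i
        pair-cell-commute = proj₂ (B.hom-surj cells)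

      pair : Square Q ×obj
      pair = square ⟨tops⟩ ⟨bottoms⟩ pair-cell (hom-surj-iso isB cells (λ i → iso-cast _ _ (cell-iso (h i))))

      pair-commute : ∀ i → ×π i ∘□ pair ≈□ h i
      pair-commute i =
        mk≈□ (A₁.commute (λ j → top (h j)) i) (B₁.commute (λ j → bottom (h j)) i)
             (≅-trans (paste-isIdˡ (isId-idTo _)) (≅-trans (≈⇒≅ (pair-cell-commute i)) (cast≅ _ _ _)))

      pair-unique : (k : Square Q ×obj) → (∀ i → ×π i ∘□ k ≈□ h i) → k ≈□ pair
      pair-unique k k-commute = mk≈□ top≡ bottom≡ (≅-trans (≅-sym (cast≅ _ _ _)) (≈⇒≅ cell≈))
        where
        top≡ : top k ≡ ⟨tops⟩
        top≡ = A₁.unique (λ j → top (h j)) (top k) (λ i → ≈-top (k-commute i))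

        bottom≡ : bottom k ≡ ⟨bottoms⟩
        bottom≡ = B₁.unique (λ j → bottom (h j)) (bottom k) (λ i → ≈-bottom (k-commute i))

        cell≈ : cast (cong (×arr ∘₁_) top≡) (cong (_∘₁ arr Q) bottom≡) (cell k) ≈₂ pair-cell
        cell≈ = B.hom-inj _ _ λ i → ≅⇒≈
          (≅-trans (∘ₕ-≅ ≅-refl (cast≅ _ _ _))
          (≅-trans (≅-sym (paste-isIdˡ (isId-idTo _)))
          (≅-trans (≈-cell (k-commute i))
          (≅-sym (≅-trans (≈⇒≅ (pair-cell-commute i)) (cast≅ _ _ _))))))

    ×obj-isProduct : Category.IsProduct SquareCat X ×obj ×π
    ×obj-isProduct = record { ⟨_⟩ = pair ; commute = pair-commute ; unique = pair-unique }

  SquareFP : FPCat (o ⊔ ℓ ⊔ t ⊔ e) (ℓ ⊔ t ⊔ e) (ℓ ⊔ e)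
  SquareFP = record
    { cat      = SquareCat
    ; products = λ n X →
        let isA = TwoProduct.is2Product (has2 n (λ i → dom (X i)))
            isB = TwoProduct.is2Product (has2 n (λ i → cod (X i)))
        in record { P = ×obj X isA isB ; π = ×π X isA isB ; isProduct = ×obj-isProduct X isA isB }
    }

  open Underlying D using (preserves-via-chosen)

  domFP : FPFunctor SquareCat underlying
  domFP = record
    { functor   = F
    ; preserves = preserves-via-chosen SquareCat (FPCat.products SquareFP) F
                    (λ n X → Is2Product.isProduct (TwoProduct.is2Product (has2 n (λ i → dom (X i)))))
    }
    where
    F : Functor SquareCat underlying
    F = record { F₀ = dom ; F₁ = top ; identity = refl ; homomorphism = refl ; F-resp-≈ = ≈-top }

  codFP : FPFunctor SquareCat underlying
  codFP = record
    { functor   = F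
    ; preserves = preserves-via-chosen SquareCat (FPCat.products SquareFP) F
                    (λ n X → Is2Product.isProduct (TwoProduct.is2Product (has2 n (λ i → cod (X i)))))
    }
    where
    F : Functor SquareCat underlying
    F = record { F₀ = cod ; F₁ = bottom ; identity = refl ; homomorphism = refl ; F-resp-≈ = ≈-bottom }

module SquareInterpretation {o ℓ t e} (D : TwoCategory o ℓ t e) (has2 : TwoCategory.HasFinite2Products D)
                            {s f} (σ : Signature s f) (M N : Interpretation σ (TwoCategory.underlying D))
                            (α-homotopy : HomotopyEquivalent σ D M N) where
  open Signature σ
  open TwoCategory D
  open TwoCells D
  open Transport D
  open TwoProducts D has2
  open Squares D
  open SquareProducts D has2
  open HomotopyHom (proj₁ α-homotopy)
  private
    module M = Interpretation M
    module N = Interpretation N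

  sortArrow : Sort → EquivArrow
  sortArrow A = equivArrow M.⟦ A ⟧ N.⟦ A ⟧ (α₁ A) (proj₂ α-homotopy A)

  sortFamily : (As : List Sort) → Fin (length As) → EquivArrow
  sortFamily As j = sortArrow (lookup As j)

  private
    M2 : (As : List Sort) → Is2Product (λ j → M.⟦ lookup As j ⟧) M.⟦ As ⟧* (M.π As)
    M2 As = product⇒2-product (M.isProduct As)

    N2 : (As : List Sort) → Is2Product (λ j → N.⟦ lookup As j ⟧) N.⟦ As ⟧* (N.π As)
    N2 As = product⇒2-product (N.isProduct As)

  chosenProduct : List Sort → EquivArrow
  chosenProduct As = ×obj (sortFamily As) (M2 As) (N2 As)

  -- An interpretation must satisfy ⟦ [ A ] ⟧* ≡ ⟦ A ⟧ on the nose, so the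
  -- one-sort product is the sort itself rather than the chosen product.
  productArrow : List Sort → EquivArrow
  productArrow []           = chosenProduct []
  productArrow (A ∷ [])     = sortArrow A
  productArrow (A ∷ B ∷ Bs) = chosenProduct (A ∷ B ∷ Bs)

  productπ : (As : List Sort) (j : Fin (length As)) → Square (productArrow As) (sortFamily As j)
  productπ []           = ×π (sortFamily []) (M2 []) (N2 [])
  productπ (A ∷ [])     = λ { zero → id□ }
  productπ (A ∷ B ∷ Bs) = ×π (sortFamily (A ∷ B ∷ Bs)) (M2 (A ∷ B ∷ Bs)) (N2 (A ∷ B ∷ Bs))

  product-isProduct : (As : List Sort) →
                      Category.IsProduct SquareCat (sortFamily As) (productArrow As) (productπ As)
  product-isProduct []           = ×obj-isProduct (sortFamily []) (M2 []) (N2 [])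
  product-isProduct (A ∷ [])     = singleton-isProduct SquareCat (sortFamily (A ∷ [])) (productπ (A ∷ [])) ≈□-refl
  product-isProduct (A ∷ B ∷ Bs) = ×obj-isProduct (sortFamily (A ∷ B ∷ Bs)) (M2 (A ∷ B ∷ Bs)) (N2 (A ∷ B ∷ Bs))

  funSquare : ∀ {As B} → Fun As B → Square (chosenProduct As) (sortArrow B)
  funSquare g = square M.⟦ g ⟧f N.⟦ g ⟧f (α₂ g) (α₂-iso g)

  singletonSquare : (A : Sort) → Square (sortArrow A) (chosenProduct (A ∷ []))
  singletonSquare A =
    square ⌜ sym (M.single A) ⌝ ⌜ sym (N.single A) ⌝
           (idTo₂ (sym (≈[]-sym (M.single A) (N.single A) ×map-single))) (iso-idTo _)
    where
    ×map-single : ×map σ underlying M N α₁ (A ∷ []) ≈[ M.single A , N.single A ] α₁ A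
    ×map-single =
      trans (cong (_∘₁ ×map σ underlying M N α₁ (A ∷ [])) (sym (N.single-π A)))
            (trans (Category.IsProduct.commute (N.isProduct (A ∷ [])) _ zero) (cong (α₁ A ∘₁_) (M.single-π A)))

  productFunSquare : ∀ {As B} → Fun As B → Square (productArrow As) (sortArrow B)
  productFunSquare {[]}         g = funSquare g
  productFunSquare {A ∷ []}     g = funSquare g ∘□ singletonSquare A
  productFunSquare {A ∷ B ∷ Bs} g = funSquare g

  interpretation : Interpretation σ SquareCat
  interpretation = record
    { ⟦_⟧       = sortArrow
    ; ⟦_⟧*      = productArrow
    ; π         = productπ
    ; isProduct = product-isProduct
    ; single    = λ A → refl
    ; single-π  = λ A → ≈□-refl
    ; ⟦_⟧f      = productFunSquare
    }

  dom-product≡ : (As : List Sort) → dom (productArrow As) ≡ M.⟦ As ⟧*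
  dom-product≡ []           = refl
  dom-product≡ (A ∷ [])     = sym (M.single A)
  dom-product≡ (A ∷ B ∷ Bs) = refl

  cod-product≡ : (As : List Sort) → cod (productArrow As) ≡ N.⟦ As ⟧*
  cod-product≡ []           = refl
  cod-product≡ (A ∷ [])     = sym (N.single A)
  cod-product≡ (A ∷ B ∷ Bs) = refl

  private
    id∘f≡f∘id : ∀ {X Y} {f : X ⇒₁ Y} → id₁ ∘₁ f ≡ f ∘₁ id₁
    id∘f≡f∘id = trans identityˡ₁ (sym identityʳ₁)

  dom-π : (As : List Sort) (j : Fin (length As)) →
          top (productπ As j) ≈[ dom-product≡ As , refl ] M.π As j
  dom-π []           j    = id∘f≡f∘id
  dom-π (A ∷ [])     zero = trans identityˡ₁ (sym (trans (cong (_∘₁ ⌜ sym (M.single A) ⌝) (M.single-π A))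
                                                         (⌜⌝-inverse (M.single A))))
  dom-π (A ∷ B ∷ Bs) j    = id∘f≡f∘id

  cod-π : (As : List Sort) (j : Fin (length As)) →
          bottom (productπ As j) ≈[ cod-product≡ As , refl ] N.π As j
  cod-π []           j    = id∘f≡f∘id
  cod-π (A ∷ [])     zero = trans identityˡ₁ (sym (trans (cong (_∘₁ ⌜ sym (N.single A) ⌝) (N.single-π A))
                                                         (⌜⌝-inverse (N.single A))))
  cod-π (A ∷ B ∷ Bs) j    = id∘f≡f∘id

  dom-fun : ∀ As {B} (g : Fun As B) → top (productFunSquare g) ≈[ dom-product≡ As , refl ] M.⟦ g ⟧f
  dom-fun []           g = id∘f≡f∘id
  dom-fun (A ∷ [])     g = identityˡ₁
  dom-fun (A ∷ B ∷ Bs) g = id∘f≡f∘id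

  cod-fun : ∀ As {B} (g : Fun As B) → bottom (productFunSquare g) ≈[ cod-product≡ As , refl ] N.⟦ g ⟧f
  cod-fun []           g = id∘f≡f∘id
  cod-fun (A ∷ [])     g = identityˡ₁
  cod-fun (A ∷ B ∷ Bs) g = id∘f≡f∘id

  domFP∘interpretation≐M : _≐_ σ underlying (_∘I_ σ domFP interpretation) M
  domFP∘interpretation≐M = record
    { sort≡ = λ A → refl ; prod≡ = dom-product≡ ; π≈ = dom-π ; fun≈ = λ {As} g → dom-fun As g }

  codFP∘interpretation≐N : _≐_ σ underlying (_∘I_ σ codFP interpretation) N
  codFP∘interpretation≐N = record
    { sort≡ = λ A → refl ; prod≡ = cod-product≡ ; π≈ = cod-π ; fun≈ = λ {As} g → cod-fun As g }

module TransportPseudoNat {o′ ℓ′ t′ e′} (D : TwoCategory o′ ℓ′ t′ e′)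
                          {o ℓ e} {C : Category o ℓ e} {G₁ G₂ H₁ H₂ : FPFunctor C (TwoCategory.underlying D)}
                          (e₁ : _≐F_ C (TwoCategory.underlying D) G₁ H₁)
                          (e₂ : _≐F_ C (TwoCategory.underlying D) G₂ H₂) where
  open TwoCategory D
  open TwoCells D
  open Transport D
  private
    module C = Category C
    module G₁ = FPFunctor G₁
    module G₂ = FPFunctor G₂
    module H₁ = FPFunctor H₁
    module H₂ = FPFunctor H₂
    module e₁ = _≐F_ e₁
    module e₂ = _≐F_ e₂

  module _ (β : PseudoNat D G₁ G₂) where
    open PseudoNat β
    private
      a = e₁.obj≡
      b = e₂.obj≡

      β₁′ : ∀ X → H₁.F₀ X ⇒₁ H₂.F₀ X
      β₁′ X = tr₁ (a X) (b X) (β₁ X)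

      -- Conjugating by the object equalities keeps 2-cells in a single hom-category,
      -- where _≅_ compares them.
      conjugate₂ : ∀ {X Y} {u v : G₁.F₀ X ⇒₁ G₂.F₀ Y} → u ⇒₂ v →
                   ⌜ b Y ⌝ ∘₁ (u ∘₁ ⌜ sym (a X) ⌝) ⇒₂ ⌜ b Y ⌝ ∘₁ (v ∘₁ ⌜ sym (a X) ⌝)
      conjugate₂ φ = id₂ ∘ₕ (φ ∘ₕ id₂)

      isId-conjugate₂ : ∀ {X Y} {u v : G₁.F₀ X ⇒₁ G₂.F₀ Y} {φ : u ⇒₂ v} → IsId₂ φ → IsId₂ (conjugate₂ φ)
      isId-conjugate₂ φ-id = isId-∘ₕ isId-id (isId-∘ₕ φ-id isId-id)

      β₂′ : ∀ {X Y} (f : X C.⇒ Y) → β₁′ Y ∘₁ H₁.F₁ f ⇒₂ H₂.F₁ f ∘₁ β₁′ X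
      β₂′ {X} {Y} f = cast (sym (tr₁-∘₁-conjugate (a X) (a Y) (b Y) (e₁.hom≈ f)))
                           (conjugate-∘₁-tr₁ (a X) (b X) (b Y) (e₂.hom≈ f))
                           (conjugate₂ (β₂ f))

      β₂′≅ : ∀ {X Y} (f : X C.⇒ Y) → β₂′ f ≅ conjugate₂ (β₂ f)
      β₂′≅ f = cast≅ _ _ _

      β₂′-resp : ∀ {X Y} {f g : X C.⇒ Y} (p : f C.≈ g) →
                 idTo₂ (cong (_∘₁ β₁′ X) (H₂.F-resp-≈ p)) ∘ᵥ β₂′ f
                   ≈₂ β₂′ g ∘ᵥ idTo₂ (cong (β₁′ Y ∘₁_) (H₁.F-resp-≈ p))
      β₂′-resp {f = f} {g} p = ≅⇒≈
        (≅-trans (idTo₂-absorbˡ _) (≅-trans (β₂′≅ f) (≅-trans (∘ₕ-≅ ≅-refl (∘ₕ-≅ β₂f≅β₂g ≅-refl))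
          (≅-trans (≅-sym (β₂′≅ g)) (≅-sym (idTo₂-absorbʳ _))))))
        where
        β₂f≅β₂g : β₂ f ≅ β₂ g
        β₂f≅β₂g = ≅-trans (≅-sym (idTo₂-absorbˡ _)) (≅-trans (≈⇒≅ (β₂-resp p)) (idTo₂-absorbʳ _))

      β₂′-comp : ∀ {X Y Z} (f : X C.⇒ Y) (g : Y C.⇒ Z) →
                 (id₂ {f = H₂.F₁ g} ∘ₕ β₂′ f) ∘ᵥ idTo₂ assoc₁ ∘ᵥ (β₂′ g ∘ₕ id₂ {f = H₁.F₁ f})
                   ∘ᵥ idTo₂ (trans (cong (β₁′ Z ∘₁_) H₁.homomorphism) (sym assoc₁))
                 ≈₂ idTo₂ (trans (cong (_∘₁ β₁′ X) H₂.homomorphism) assoc₁) ∘ᵥ β₂′ (g C.∘ f)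
      β₂′-comp {X} {Y} {Z} f g = ≅⇒≈ (≅-trans lhs (≅-sym rhs))
        where
        whiskered-f : id₂ {f = H₂.F₁ g} ∘ₕ β₂′ f ≅ conjugate₂ (id₂ {f = G₂.F₁ g} ∘ₕ β₂ f)
        whiskered-f =
          ≅-trans (∘ₕ-≅ ≅-refl (β₂′≅ f)) (≅-trans whiskerˡ-whiskerˡ
          (≅-trans (∘ₕ-≅ (id₂-≅ (sym (e₂.hom≈ g))) ≅-refl) (≅-trans (≅-sym whiskerˡ-whiskerˡ)
          (∘ₕ-≅ ≅-refl (≅-sym assocₕ≅)))))

        whiskered-g : β₂′ g ∘ₕ id₂ {f = H₁.F₁ f} ≅ conjugate₂ (β₂ g ∘ₕ id₂ {f = G₁.F₁ f})
        whiskered-g =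
          ≅-trans (∘ₕ-≅ (β₂′≅ g) ≅-refl) (≅-trans assocₕ≅ (≅-trans (∘ₕ-≅ ≅-refl assocₕ≅)
          (≅-trans (∘ₕ-≅ ≅-refl (∘ₕ-≅ ≅-refl ∘ₕ-id≅))
          (≅-trans (∘ₕ-≅ ≅-refl (∘ₕ-≅ ≅-refl (id₂-≅ (≈[]-sym (a X) (a Y) (e₁.hom≈ f)))))
          (≅-trans (∘ₕ-≅ ≅-refl (∘ₕ-≅ ≅-refl (≅-sym ∘ₕ-id≅))) (∘ₕ-≅ ≅-refl (≅-sym assocₕ≅)))))))

        lhs = ∘ᵥ-≅ whiskered-f
              (∘ᵥ-≅ (isId-≅-by-src (isId-idTo _) (isId-conjugate₂ (isId-idTo _)) (≅-tgt whiskered-g))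
              (∘ᵥ-≅ whiskered-g (isId-≅-by-tgt (isId-idTo _) (isId-conjugate₂ (isId-idTo _)) (≅-src whiskered-g))))

        β₂-gf : β₂ (g C.∘ f) ≅ (id₂ {f = G₂.F₁ g} ∘ₕ β₂ f) ∘ᵥ idTo₂ assoc₁ ∘ᵥ (β₂ g ∘ₕ id₂ {f = G₁.F₁ f})
                                 ∘ᵥ idTo₂ (trans (cong (β₁ Z ∘₁_) G₁.homomorphism) (sym assoc₁))
        β₂-gf = ≅-trans (≅-sym (idTo₂-absorbˡ _)) (≅-sym (≈⇒≅ (β₂-comp f g)))

        rhs = ≅-trans (idTo₂-absorbˡ _) (≅-trans (β₂′≅ (g C.∘ f))
              (≅-trans (∘ₕ-≅ ≅-refl (∘ₕ-≅ β₂-gf ≅-refl)) (≅-trans (∘ₕ-≅ ≅-refl whiskerʳ-∘ᵥ⁴) whiskerˡ-∘ᵥ⁴)))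

      β₂′-id : ∀ {X} → idTo₂ (trans (cong (_∘₁ β₁′ X) H₂.identity) identityˡ₁) ∘ᵥ β₂′ (C.id {X})
                         ≈₂ idTo₂ (trans (cong (β₁′ X ∘₁_) H₁.identity) identityʳ₁)
      β₂′-id {X} = isId-≈ (isId-∘ᵥ (isId-idTo _) (isId-cast _ _ (isId-conjugate₂ β₂-id′)))
                          (isId-idTo _)
        where
        β₂-id′ : IsId₂ (β₂ (C.id {X}))
        β₂-id′ = ≅-id₂⇒IsId₂ (≅-trans (≅-sym (idTo₂-absorbˡ _)) (≅-trans (≈⇒≅ β₂-id) (idTo₂≅ _)))

    transport-PseudoNat : PseudoNat D H₁ H₂
    transport-PseudoNat = record
      { β₁      = β₁′
      ; β₂      = β₂′
      ; β₂-iso  = λ f → iso-cast _ _ (iso-whisker (β₂-iso f))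
      ; β₂-resp = β₂′-resp
      ; β₂-comp = β₂′-comp
      ; β₂-id   = β₂′-id
      }

  transport-PseudonaturallyEquivalent : PseudonaturallyEquivalent D G₁ G₂ → PseudonaturallyEquivalent D H₁ H₂
  transport-PseudonaturallyEquivalent (β , β-equiv) =
    transport-PseudoNat β , λ X → tr₁-equivalence (e₁.obj≡ X) (e₂.obj≡ X) (β-equiv X)

module SquarePseudoNat {o′ ℓ′ t′ e′} (D : TwoCategory o′ ℓ′ t′ e′) (has2 : TwoCategory.HasFinite2Products D)
                       {o ℓ e} {C : Category o ℓ e} (F : FPFunctor C (Squares.SquareCat D)) where
  open TwoCategory D
  open TwoCells D
  open Squares D
  open SquareProducts D has2 using (domFP; codFP)
  open Underlying D using (_∘FP_)
  private
    module F = FPFunctor F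

  -- Pseudonaturality of the arrows F X is the functoriality of F on square cells.
  squares⇒PseudoNat : PseudoNat D (domFP ∘FP F) (codFP ∘FP F)
  squares⇒PseudoNat = record
    { β₁      = λ X → arr (F.F₀ X)
    ; β₂      = λ f → cell (F.F₁ f)
    ; β₂-iso  = λ f → cell-iso (F.F₁ f)
    ; β₂-resp = λ p → ≅⇒≈ (≅-trans (idTo₂-absorbˡ _) (≅-trans (≈-cell (F.F-resp-≈ p)) (≅-sym (idTo₂-absorbʳ _))))
    ; β₂-comp = λ f g → ≅⇒≈ (≅-sym
        (≅-trans (idTo₂-absorbˡ _) (≅-trans (≈-cell (F.homomorphism {f = f} {g = g})) (≅-trans (idTo₂-absorbˡ _)
          (∘ᵥ-≅ ≅-refl (∘ᵥ-≅ ≅-refl (∘ᵥ-≅ ≅-refl (isId-≅-by-tgt (isId-idTo _) (isId-idTo _) refl))))))))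
    ; β₂-id   = λ {X} → isId-≈ (isId-∘ᵥ (isId-idTo _) (≅-id₂⇒IsId₂ (≅-trans (≈-cell (F.identity {X})) (idTo₂≅ _))))
                                (isId-idTo _)
    }

  squares⇒PseudonaturallyEquivalent : PseudonaturallyEquivalent D (domFP ∘FP F) (codFP ∘FP F)
  squares⇒PseudonaturallyEquivalent = squares⇒PseudoNat , λ X → arr-equiv (F.F₀ X)

module HomotopyToPseudonatural {s f} (σ : Signature s f) {o ℓ e} (C : FPCat o ℓ e)
                               (i : Interpretation σ (FPCat.cat C)) (free : IsFree σ C i)
                               {o′ ℓ′ t′ e′} (D : TwoCategory o′ ℓ′ t′ e′)
                               (has2 : TwoCategory.HasFinite2Products D) where
  open TwoCategory D using (underlying)
  open Transport D using (≐-sym; ≐-trans)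
  open Underlying D
  open SquareProducts D has2 using (SquareFP; domFP; codFP)

  ≐F-from-restriction : ∀ {o₂ ℓ₂ e₂} {E : Category o₂ ℓ₂ e₂} {I : Interpretation σ E}
                        {K : Interpretation σ underlying} {K̃ : FPFunctor (FPCat.cat C) underlying}
                        (F : FPFunctor (FPCat.cat C) E) (G : FPFunctor E underlying) →
                        _≐_ σ E (_∘I_ σ F i) I → _≐_ σ underlying (_∘I_ σ G I) K →
                        _≐_ σ underlying (_∘I_ σ K̃ i) K → _≐F_ (FPCat.cat C) underlying (G ∘FP F) K̃
  ≐F-from-restriction {K̃ = K̃} F G F∘i≐I G∘I≐K K̃∘i≐K =
    PrecompIso.obj-inj (free (underlyingFP has2)) (G ∘FP F) K̃
      (≐-trans σ (∘FP-∘I σ G F i) (≐-trans σ (≐-∘I σ G F∘i≐I) (≐-trans σ G∘I≐K (≐-sym σ K̃∘i≐K))))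

  module _ (M N : Interpretation σ underlying) (M̃ Ñ : FPFunctor (FPCat.cat C) underlying)
           (hM : _≐_ σ underlying (_∘I_ σ M̃ i) M) (hN : _≐_ σ underlying (_∘I_ σ Ñ i) N) where

    homotopy⇒pseudonatural : HomotopyEquivalent σ D M N → PseudonaturallyEquivalent D M̃ Ñ
    homotopy⇒pseudonatural α =
      TransportPseudoNat.transport-PseudonaturallyEquivalent D
        (≐F-from-restriction F domFP F∘i≐I domFP∘interpretation≐M hM)
        (≐F-from-restriction F codFP F∘i≐I codFP∘interpretation≐N hN)
        (SquarePseudoNat.squares⇒PseudonaturallyEquivalent D has2 F)
      where
      open SquareInterpretation D has2 σ M N α
      lift = PrecompIso.obj-surj (free SquareFP) interpretation
      F = proj₁ lift
      F∘i≐I = proj₂ lift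

theorem4p4p6 : ∀ {s f o ℓ e} (σ : Signature s f) (C : FPCat o ℓ e)
    (i : Interpretation σ (FPCat.cat C)) → IsFree σ C i →
    ∀ {o′ ℓ′ t′ e′} (D : TwoCategory o′ ℓ′ t′ e′) → TwoCategory.HasFinite2Products D →
    (M N : Interpretation σ (TwoCategory.underlying D)) →
    (M̃ Ñ : FPFunctor (FPCat.cat C) (TwoCategory.underlying D)) →
    _≐_ σ (TwoCategory.underlying D) (_∘I_ σ M̃ i) M →
    _≐_ σ (TwoCategory.underlying D) (_∘I_ σ Ñ i) N →
    HomotopyEquivalent σ D M N ⇔ PseudonaturallyEquivalent D M̃ Ñ
theorem4p4p6 σ C i free D has2 M N M̃ Ñ hM hN =
  mk⇔ (HomotopyToPseudonatural.homotopy⇒pseudonatural σ C i free D has2 M N M̃ Ñ hM hN)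
      (λ β → Transport.homotopyEquivalent-≐ D σ hM hN
               (Restriction.restrict-pseudonatural D has2 σ i M̃ Ñ β))
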